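{- Let $\mathcal{E}$ be the set of $\mathbf{x}=(x_0,x_1,x_2,x_3)\in\mathbb{Z}^4$ with $\gcd(x_0,\dots,x_3)=1$, $x_0x_1x_2x_3\ne0$, $x_0,x_2>0$ and $x_1x_2^2+x_2x_0^2+x_3^3=0$. Let $\mathcal{T}_1$ be the set of $(\xi_1,\xi_2,\xi_3,\xi_\ell,\xi_4,\xi_5,\xi_6,\tau_1,\tau_2,\tau_\ell)\in\mathbb{N}^7\times\mathbb{Z}_*\times\mathbb{N}\times\mathbb{Z}_*$ satisfying $$\tau_\ell\xi_\ell^3\xi_4^2\xi_5+\tau_2^2\xi_2+\tau_1^3\xi_1^2\xi_3=0,$$ $\xi_1\xi_2\xi_3\xi_4\xi_5$ squarefree, $\gcd(\tau_1,\xi_2\xi_\ell\xi_4\xi_5)=1$, $\gcd(\tau_2,\xi_1\xi_3)=1$ and $\gcd(\tau_\ell,\xi_4\xi_5\xi_6)=1$. Define $\Psi$ by $$\Psi(\boldsymbol{\xi},\boldsymbol{\tau})=\big(\xi_1\xi_2^2\xi_3^2\xi_4\xi_5^2\xi_6^3\tau_2,\ \tau_\ell,\ \xi_1^2\xi_2^3\xi_3^4\xi_\ell^3\xi_4^4\xi_5^5\xi_6^6,\ \xi_1^2\xi_2^2\xi_3^3\xi_\ell\xi_4^2\xi_5^3\xi_6^4\tau_1\big).$$ Then $\Psi$ restricts to a bijection from $\mathcal{T}_1$ onto $\mathcal{E}$.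
   Context: $\mathbb{N}$ denotes the positive integers and $\mathbb{Z}_*$ the nonzero integers. -}

module Defs where

open import Data.Nat as ℕ using (ℕ)
open import Data.Nat.Primality using (Prime)
open import Data.Nat.Divisibility as ℕD using ()
open import Data.Integer using (ℤ; +_; _+_; _*_; _^_; _<_; 0ℤ; 1ℤ)
open import Data.Integer.GCD using (gcd)
open import Data.Product using (_×_; Σ; _,_)
open import Relation.Nullary using (¬_)
open import Relation.Binary.PropositionalEquality using (_≡_; _≢_)

SquareFree : ℕ → Set
SquareFree n = ∀ p → Prime p → ¬ (p ℕ.* p ℕD.∣ n)

record Z4 : Set where
  constructor z4
  field
    x0 x1 x2 x3 : ℤ

E : Z4 → Set
E (z4 x0 x1 x2 x3) =
  gcd (gcd x0 x1) (gcd x2 x3) ≡ 1ℤ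
  × x0 * x1 * x2 * x3 ≢ 0ℤ
  × 0ℤ < x0 × 0ℤ < x2
  × x1 * x2 ^ 2 + x2 * x0 ^ 2 + x3 ^ 3 ≡ 0ℤ

-- tuples (ξ₁,ξ₂,ξ₃,ξℓ,ξ₄,ξ₅,ξ₆,τ₁,τ₂,τℓ); the ξ's and τ₂ are stored as
-- naturals (positivity imposed in 𝓣₁), τ₁ and τℓ as integers (nonzero in 𝓣₁)
record Tup : Set where
  constructor tup
  field
    ξ₁ ξ₂ ξ₃ ξℓ ξ₄ ξ₅ ξ₆ : ℕ
    τ₁ : ℤ
    τ₂ : ℕ
    τℓ : ℤ

T₁ : Tup → Set
T₁ (tup ξ₁ ξ₂ ξ₃ ξℓ ξ₄ ξ₅ ξ₆ τ₁ τ₂ τℓ) =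
  (0 ℕ.< ξ₁ × 0 ℕ.< ξ₂ × 0 ℕ.< ξ₃ × 0 ℕ.< ξℓ × 0 ℕ.< ξ₄ × 0 ℕ.< ξ₅ × 0 ℕ.< ξ₆)
  × τ₁ ≢ 0ℤ × 0 ℕ.< τ₂ × τℓ ≢ 0ℤ
  × τℓ * (+ ξℓ) ^ 3 * (+ ξ₄) ^ 2 * (+ ξ₅) + (+ τ₂) ^ 2 * (+ ξ₂) + τ₁ ^ 3 * (+ ξ₁) ^ 2 * (+ ξ₃) ≡ 0ℤ
  × SquareFree (ξ₁ ℕ.* ξ₂ ℕ.* ξ₃ ℕ.* ξ₄ ℕ.* ξ₅)
  × gcd τ₁ (+ (ξ₂ ℕ.* ξℓ ℕ.* ξ₄ ℕ.* ξ₅)) ≡ 1ℤ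
  × gcd (+ τ₂) (+ (ξ₁ ℕ.* ξ₃)) ≡ 1ℤ
  × gcd τℓ (+ (ξ₄ ℕ.* ξ₅ ℕ.* ξ₆)) ≡ 1ℤ

Ψ : Tup → Z4
Ψ (tup ξ₁ ξ₂ ξ₃ ξℓ ξ₄ ξ₅ ξ₆ τ₁ τ₂ τℓ) = z4
  (+ (ξ₁ ℕ.* ξ₂ ℕ.^ 2 ℕ.* ξ₃ ℕ.^ 2 ℕ.* ξ₄ ℕ.* ξ₅ ℕ.^ 2 ℕ.* ξ₆ ℕ.^ 3 ℕ.* τ₂))
  τℓ
  (+ (ξ₁ ℕ.^ 2 ℕ.* ξ₂ ℕ.^ 3 ℕ.* ξ₃ ℕ.^ 4 ℕ.* ξℓ ℕ.^ 3 ℕ.* ξ₄ ℕ.^ 4 ℕ.* ξ₅ ℕ.^ 5 ℕ.* ξ₆ ℕ.^ 6))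
  (+ (ξ₁ ℕ.^ 2 ℕ.* ξ₂ ℕ.^ 2 ℕ.* ξ₃ ℕ.^ 3 ℕ.* ξℓ ℕ.* ξ₄ ℕ.^ 2 ℕ.* ξ₅ ℕ.^ 3 ℕ.* ξ₆ ℕ.^ 4) * τ₁)

module Submission where

-- Everything happens one prime p at a time. With αᵢ, βᵢ the p-adic valuations of ξᵢ, τᵢ, the
-- valuations of the coordinates of Ψ(ξ, τ) are linear forms ψ₀, …, ψ₃ in them. In a vanishing sum of
-- three nonzero integers the smallest valuation occurs twice. For the torsor equation this, together
-- with the squarefree and coprimality conditions, leaves a short list of exponent patterns on which ψ
-- has an explicit inverse (decode); for the equation of 𝓔, together with primitivity, it shows that
-- the valuations of every point of 𝓔 arise from such a pattern. Injectivity of Ψ then follows from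
-- unique factorisation; for surjectivity the ξ's and τ's are assembled as products of prime powers
-- read off from decode, and the torsor equation follows from curve(Ψ(ξ, τ)) = c(ξ) · torsor(ξ, τ)
-- with c(ξ) a positive monomial.

open import Defs
open import Data.Product using (_×_; Σ; _,_)
open import Relation.Binary.PropositionalEquality using (_≡_)

module Valuation where

  open import Data.Nat.Base
  open import Data.Nat.Properties
  open import Data.Nat.Divisibility
  open import Data.Nat.Primality
  open import Data.Nat.GCD using (gcd; gcd[m,n]∣m; gcd[m,n]∣n; gcd-greatest; gcd[m,n]≢0)
  open import Data.Nat.Primality.Factorisation using (factorise)
  open import Data.Nat.ListAction using (product)
  open import Data.List.Base using (List; []; _∷_)
  open import Data.List.Relation.Unary.All using (All; []; _∷_)
  open import Data.Product.Base using (Σ; _×_; _,_; proj₁; proj₂)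
  open import Data.Sum.Base using (_⊎_; inj₁; inj₂; [_,_]′)
  open import Data.Empty using (⊥; ⊥-elim)
  open import Relation.Nullary using (¬_; Dec; yes; no; contradiction)
  open import Relation.Binary.PropositionalEquality
  open import Function.Base using (_∘_)

  prime>1 : ∀ {p} → Prime p → 1 < p
  prime>1 {p} pr = nonTrivial⇒n>1 p {{prime⇒nonTrivial pr}}

  prime>0 : ∀ {p} → Prime p → 0 < p
  prime>0 pr = <-trans z<s (prime>1 pr)

  *-pos : ∀ {m n} → 0 < m → 0 < n → 0 < m * n
  *-pos {suc m} {suc n} _ _ = z<s

  ^-pos : ∀ {m} n → 0 < m → 0 < m ^ n
  ^-pos {m} n 0<m = m^n>0 m {{>-nonZero 0<m}} n

  *-posˡ : ∀ m n → 0 < m * n → 0 < m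
  *-posˡ (suc m) n _ = z<s

  ExactPower : ℕ → ℕ → ℕ → Set
  ExactPower p k n = p ^ k ∣ n × ¬ (p ^ suc k ∣ n)

  -- Repeated division by p; n steps of fuel suffice since every division shrinks the number.
  ν-loop : ℕ → ℕ → ℕ → ℕ
  ν-loop zero    p n = 0
  ν-loop (suc f) p n with p ∣? n
  ... | yes (divides q _) = suc (ν-loop f p q)
  ... | no _ = 0

  ν : ℕ → ℕ → ℕ
  ν p n = ν-loop n p n

  ν-loop-exact : ∀ {p} → Prime p → ∀ f n → n ≤ f → 0 < n → ExactPower p (ν-loop f p n) n
  ν-loop-exact pr zero n n≤0 0<n = contradiction (≤-trans 0<n n≤0) λ ()
  ν-loop-exact {p} pr (suc f) n n≤f 0<n with p ∣? n
  ... | no p∤n = 1∣ n , λ p∣n → p∤n (subst (_∣ n) (*-identityʳ p) p∣n)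
  ... | yes (divides q n≡qp) = pᵏ⁺¹∣n , pᵏ⁺²∤n
    where
    instance _ = prime⇒nonZero pr
    0<q : 0 < q
    0<q = *-posˡ q p (subst (0 <_) n≡qp 0<n)
    q<n : q < n
    q<n = subst (q <_) (sym n≡qp) (m<m*n q p {{>-nonZero 0<q}} (prime>1 pr))
    IH = ν-loop-exact pr f q (≤-pred (≤-trans q<n n≤f)) 0<q
    k = ν-loop f p q
    pᵏ⁺¹∣n : p ^ suc k ∣ n
    pᵏ⁺¹∣n = subst₂ _∣_ (*-comm (p ^ k) p) (sym n≡qp) (*-monoˡ-∣ p (proj₁ IH))
    pᵏ⁺²∤n : ¬ (p ^ suc (suc k) ∣ n)
    pᵏ⁺²∤n h = proj₂ IH (*-cancelʳ-∣ p (subst₂ _∣_ (*-comm p (p ^ suc k)) n≡qp h))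

  ν-exact : ∀ {p n} → Prime p → 0 < n → ExactPower p (ν p n) n
  ν-exact {n = n} pr = ν-loop-exact pr n n ≤-refl

  ^-monoʳ-∣ : ∀ p {a b} → a ≤ b → p ^ a ∣ p ^ b
  ^-monoʳ-∣ p {a} {b} a≤b = divides (p ^ (b ∸ a)) (begin
    p ^ b             ≡⟨ cong (p ^_) (sym (m∸n+n≡m a≤b)) ⟩
    p ^ (b ∸ a + a)   ≡⟨ ^-distribˡ-+-* p (b ∸ a) a ⟩
    p ^ (b ∸ a) * p ^ a ∎)
    where open ≡-Reasoning

  ^∣⇒≤ν : ∀ {p k n} → Prime p → 0 < n → p ^ k ∣ n → k ≤ ν p n
  ^∣⇒≤ν {p} {k} {n} pr 0<n pᵏ∣n with k ≤? ν p n
  ... | yes k≤ν = k≤ν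
  ... | no k≰ν = contradiction (∣-trans (^-monoʳ-∣ p (≰⇒> k≰ν)) pᵏ∣n) (proj₂ (ν-exact pr 0<n))

  ≤ν⇒^∣ : ∀ {p k n} → Prime p → 0 < n → k ≤ ν p n → p ^ k ∣ n
  ≤ν⇒^∣ {p} pr 0<n k≤ν = ∣-trans (^-monoʳ-∣ p k≤ν) (proj₁ (ν-exact pr 0<n))

  exact⇒≡ν : ∀ {p k n} → Prime p → 0 < n → ExactPower p k n → k ≡ ν p n
  exact⇒≡ν {p} {k} {n} pr 0<n (pᵏ∣n , pᵏ⁺¹∤n) =
    ≤-antisym (^∣⇒≤ν pr 0<n pᵏ∣n) (≮⇒≥ λ k<ν → pᵏ⁺¹∤n (≤ν⇒^∣ pr 0<n k<ν))

  ∣⇒ν>0 : ∀ {p n} → Prime p → 0 < n → p ∣ n → 0 < ν p n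
  ∣⇒ν>0 {p} pr 0<n p∣n = ^∣⇒≤ν pr 0<n (subst (_∣ _) (sym (*-identityʳ p)) p∣n)

  ν>0⇒∣ : ∀ {p n} → Prime p → 0 < n → 0 < ν p n → p ∣ n
  ν>0⇒∣ {p} pr 0<n ν>0 = subst (_∣ _) (*-identityʳ p) (≤ν⇒^∣ pr 0<n ν>0)

  exact-* : ∀ {p i j m n} → Prime p → ExactPower p i m → ExactPower p j n → ExactPower p (i + j) (m * n)
  exact-* {p} {i} {j} {m} {n} pr (pⁱ∣m , pⁱ⁺¹∤m) (pʲ∣n , pʲ⁺¹∤n) = pⁱ⁺ʲ∣mn , pⁱ⁺ʲ⁺¹∤mn
    where
    instance _ = prime⇒nonZero pr
    m′ = quotient pⁱ∣m
    n′ = quotient pʲ∣n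
    p∤m′ : ¬ (p ∣ m′)
    p∤m′ p∣m′ = pⁱ⁺¹∤m (subst (p ^ suc i ∣_) (sym (m∣n⇒n≡quotient*m pⁱ∣m)) (*-monoˡ-∣ (p ^ i) p∣m′))
    p∤n′ : ¬ (p ∣ n′)
    p∤n′ p∣n′ = pʲ⁺¹∤n (subst (p ^ suc j ∣_) (sym (m∣n⇒n≡quotient*m pʲ∣n)) (*-monoˡ-∣ (p ^ j) p∣n′))
    pⁱ⁺ʲ∣mn : p ^ (i + j) ∣ m * n
    pⁱ⁺ʲ∣mn = subst (_∣ m * n) (sym (^-distribˡ-+-* p i j)) (*-pres-∣ pⁱ∣m pʲ∣n)
    mn≡ : m * n ≡ (m′ * n′) * p ^ (i + j)
    mn≡ = begin
      m * n                       ≡⟨ cong₂ _*_ (m∣n⇒n≡quotient*m pⁱ∣m) (m∣n⇒n≡quotient*m pʲ∣n) ⟩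
      (m′ * p ^ i) * (n′ * p ^ j) ≡⟨ [m*n]*[o*p]≡[m*o]*[n*p] m′ (p ^ i) n′ (p ^ j) ⟩
      (m′ * n′) * (p ^ i * p ^ j) ≡⟨ cong ((m′ * n′) *_) (^-distribˡ-+-* p i j) ⟨
      (m′ * n′) * p ^ (i + j)     ∎
      where open ≡-Reasoning
    pⁱ⁺ʲ⁺¹∤mn : ¬ (p ^ suc (i + j) ∣ m * n)
    pⁱ⁺ʲ⁺¹∤mn h with euclidsLemma m′ n′ pr (*-cancelʳ-∣ (p ^ (i + j)) {{m^n≢0 p (i + j)}} (subst (p ^ suc (i + j) ∣_) mn≡ h))
    ... | inj₁ p∣m′ = p∤m′ p∣m′
    ... | inj₂ p∣n′ = p∤n′ p∣n′

  ν-* : ∀ {p m n} → Prime p → 0 < m → 0 < n → ν p (m * n) ≡ ν p m + ν p n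
  ν-* {p} {m} {n} pr 0<m 0<n =
    sym (exact⇒≡ν pr (*-pos 0<m 0<n) (exact-* {i = ν p m} {j = ν p n} pr (ν-exact pr 0<m) (ν-exact pr 0<n)))

  ν-1 : ∀ {p} → Prime p → ν p 1 ≡ 0
  ν-1 {p} pr = sym (exact⇒≡ν pr z<s (1∣ 1 , λ p∣1 → <⇒≱ (prime>1 pr) (∣⇒≤ (subst (_∣ 1) (*-identityʳ p) p∣1))))

  ν-^ : ∀ {p m} → Prime p → 0 < m → ∀ k → ν p (m ^ k) ≡ k * ν p m
  ν-^ pr 0<m zero = ν-1 pr
  ν-^ {p} {m} pr 0<m (suc k) = trans (ν-* pr 0<m (^-pos k 0<m)) (cong (ν p m +_) (ν-^ pr 0<m k))

  ν-self : ∀ {p} → Prime p → ν p p ≡ 1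
  ν-self {p} pr = sym (exact⇒≡ν pr (prime>0 pr) (subst (_∣ p) (sym (*-identityʳ p)) ∣-refl , p²∤p))
    where
    instance _ = prime⇒nonZero pr
    p²∤p : ¬ (p ^ 2 ∣ p)
    p²∤p h = <⇒≱ (subst (p <_) (cong (p *_) (sym (*-identityʳ p))) (m<m*n p p (prime>1 pr))) (∣⇒≤ h)

  ν-other : ∀ {p q} → Prime p → Prime q → p ≢ q → ν p q ≡ 0
  ν-other {p} {q} pr qr p≢q = sym (exact⇒≡ν pr (prime>0 qr) (1∣ q , p∤q ∘ subst (_∣ q) (*-identityʳ p)))
    where
    p∤q : ¬ (p ∣ q)
    p∤q p∣q with prime⇒irreducible qr p∣q
    ... | inj₁ refl = <-irrefl refl (prime>1 pr)
    ... | inj₂ p≡q = p≢q p≡q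

  n<p⇒ν≡0 : ∀ {p n} → Prime p → 0 < n → n < p → ν p n ≡ 0
  n<p⇒ν≡0 {p} {n} pr 0<n n<p with ν p n ≟ 0
  ... | yes ν≡0 = ν≡0
  ... | no ν≢0 = contradiction (∣⇒≤ {{>-nonZero 0<n}} (ν>0⇒∣ pr 0<n (n≢0⇒n>0 ν≢0))) (<⇒≱ n<p)

  primeFactor : ∀ n → 1 < n → Σ ℕ λ p → Prime p × p ∣ n
  primeFactor 1 (s<s ())
  primeFactor n@(suc (suc _)) _ with factorise n
  ... | record { factors = [] ; isFactorisation = () }
  ... | record { factors = p ∷ ps ; isFactorisation = eq ; factorsPrime = pr ∷ _ } =
    p , pr , subst (p ∣_) (sym eq) (m∣m*n (product ps))

  ≡-by-ν : ∀ {m n} → 0 < m → 0 < n → (∀ p → Prime p → ν p m ≡ ν p n) → m ≡ n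
  ≡-by-ν {m} = go m ≤-refl
    where
    go : ∀ {m n} f → m ≤ f → 0 < m → 0 < n → (∀ p → Prime p → ν p m ≡ ν p n) → m ≡ n
    go {1} {1} _ _ _ _ _ = refl
    go {1} {n@(suc (suc _))} _ _ _ 0<n νm≡νn with primeFactor n (s<s z<s)
    ... | p , pr , p∣n = ⊥-elim (<-irrefl (trans (sym (ν-1 pr)) (νm≡νn p pr)) (∣⇒ν>0 pr 0<n p∣n))
    go {m@(suc (suc _))} {n} (suc f) m≤f 0<m 0<n νm≡νn with primeFactor m (s<s z<s)
    ... | p , pr , p∣m = begin
      m        ≡⟨ m∣n⇒n≡quotient*m p∣m ⟩
      m′ * p   ≡⟨ cong (_* p) m′≡n′ ⟩
      n′ * p   ≡⟨ m∣n⇒n≡quotient*m p∣n ⟨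
      n        ∎
      where
      open ≡-Reasoning
      instance _ = prime⇒nonTrivial pr
      p∣n : p ∣ n
      p∣n = ν>0⇒∣ pr 0<n (subst (0 <_) (νm≡νn p pr) (∣⇒ν>0 pr 0<m p∣m))
      m′ = quotient p∣m
      n′ = quotient p∣n
      0<m′ : 0 < m′
      0<m′ = *-posˡ m′ p (subst (0 <_) (m∣n⇒n≡quotient*m p∣m) 0<m)
      0<n′ : 0 < n′
      0<n′ = *-posˡ n′ p (subst (0 <_) (m∣n⇒n≡quotient*m p∣n) 0<n)
      νm′≡νn′ : ∀ q → Prime q → ν q m′ ≡ ν q n′
      νm′≡νn′ q qr = +-cancelʳ-≡ (ν q p) _ _ (begin
        ν q m′ + ν q p  ≡⟨ ν-* qr 0<m′ (prime>0 pr) ⟨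
        ν q (m′ * p)    ≡⟨ cong (ν q) (m∣n⇒n≡quotient*m p∣m) ⟨
        ν q m           ≡⟨ νm≡νn q qr ⟩
        ν q n           ≡⟨ cong (ν q) (m∣n⇒n≡quotient*m p∣n) ⟩
        ν q (n′ * p)    ≡⟨ ν-* qr 0<n′ (prime>0 pr) ⟩
        ν q n′ + ν q p  ∎)
      m′≡n′ : m′ ≡ n′
      m′≡n′ = go f (≤-pred (≤-trans (quotient-< p∣m) m≤f)) 0<m′ 0<n′ νm′≡νn′

  gcd≡1⇒¬common-prime : ∀ {m n p} → gcd m n ≡ 1 → Prime p → p ∣ m → p ∣ n → ⊥
  gcd≡1⇒¬common-prime {p = p} gcd≡1 pr p∣m p∣n =
    <⇒≱ (prime>1 pr) (∣⇒≤ (subst (p ∣_) gcd≡1 (gcd-greatest p∣m p∣n)))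

  gcd-pos : ∀ {m} n → 0 < m → 0 < gcd m n
  gcd-pos {m} n 0<m = n≢0⇒n>0 (gcd[m,n]≢0 m n (inj₁ λ m≡0 → <-irrefl (sym m≡0) 0<m))

  ¬common-prime⇒gcd≡1 : ∀ {m n} → 0 < m → (∀ p → Prime p → p ∣ m → p ∣ n → ⊥) → gcd m n ≡ 1
  ¬common-prime⇒gcd≡1 {m} {n} 0<m noCommon
    with gcd m n | gcd[m,n]∣m m n | gcd[m,n]∣n m n | gcd[m,n]≢0 m n (inj₁ λ m≡0 → <-irrefl (sym m≡0) 0<m)
  ... | 0 | _ | _ | g≢0 = ⊥-elim (g≢0 refl)
  ... | 1 | _ | _ | _ = refl
  ... | g@(suc (suc _)) | g∣m | g∣n | _ with primeFactor g (s<s z<s)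
  ... | p , pr , p∣g = ⊥-elim (noCommon p pr (∣-trans p∣g g∣m) (∣-trans p∣g g∣n))

  Disjoint : ℕ → ℕ → Set
  Disjoint a b = a ≡ 0 ⊎ b ≡ 0

  gcd≡1⇒ν-disjoint : ∀ {m n p} → gcd m n ≡ 1 → Prime p → 0 < m → 0 < n → Disjoint (ν p m) (ν p n)
  gcd≡1⇒ν-disjoint {m} {n} {p} gcd≡1 pr 0<m 0<n with ν p m ≟ 0 | ν p n ≟ 0
  ... | yes νm≡0 | _ = inj₁ νm≡0
  ... | _ | yes νn≡0 = inj₂ νn≡0
  ... | no νm≢0 | no νn≢0 =
    ⊥-elim (gcd≡1⇒¬common-prime gcd≡1 pr (ν>0⇒∣ pr 0<m (n≢0⇒n>0 νm≢0)) (ν>0⇒∣ pr 0<n (n≢0⇒n>0 νn≢0)))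

  ν-disjoint⇒gcd≡1 : ∀ {m n} → 0 < m → 0 < n → (∀ p → Prime p → Disjoint (ν p m) (ν p n)) → gcd m n ≡ 1
  ν-disjoint⇒gcd≡1 {m} {n} 0<m 0<n disjoint = ¬common-prime⇒gcd≡1 0<m λ p pr p∣m p∣n →
    [ (λ νm≡0 → <-irrefl (sym νm≡0) (∣⇒ν>0 pr 0<m p∣m))
    , (λ νn≡0 → <-irrefl (sym νn≡0) (∣⇒ν>0 pr 0<n p∣n)) ]′ (disjoint p pr)

  p^2≡p*p : ∀ p → p ^ 2 ≡ p * p
  p^2≡p*p p = cong (p *_) (*-identityʳ p)

  squareFree⇒ν≤1 : ∀ {n p} → SquareFree n → Prime p → 0 < n → ν p n ≤ 1
  squareFree⇒ν≤1 {n} {p} sf pr 0<n = ≮⇒≥ λ 1<ν → sf p pr (subst (_∣ n) (p^2≡p*p p) (≤ν⇒^∣ pr 0<n 1<ν))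

  ν≤1⇒squareFree : ∀ {n} → 0 < n → (∀ p → Prime p → ν p n ≤ 1) → SquareFree n
  ν≤1⇒squareFree {n} 0<n ν≤1 p pr p*p∣n =
    <⇒≱ (s<s z<s) (≤-trans (^∣⇒≤ν {k = 2} pr 0<n (subst (_∣ n) (sym (p^2≡p*p p)) p*p∣n)) (ν≤1 p pr))

  primePower : ℕ → ℕ → ℕ
  primePower p k with prime? p
  ... | yes _ = p ^ k
  ... | no _ = 1

  primePower-pos : ∀ p k → 0 < primePower p k
  primePower-pos p k with prime? p
  ... | yes pr = ^-pos k (prime>0 pr)
  ... | no _ = z<s

  ν-primePower-self : ∀ {p} → Prime p → ∀ k → ν p (primePower p k) ≡ k
  ν-primePower-self {p} pr k with prime? p
  ... | yes _ = trans (ν-^ pr (prime>0 pr) k) (trans (cong (k *_) (ν-self pr)) (*-identityʳ k))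
  ... | no ¬pr = contradiction pr ¬pr

  ν-primePower-other : ∀ {q} → Prime q → ∀ p k → p ≢ q → ν q (primePower p k) ≡ 0
  ν-primePower-other {q} qr p k p≢q with prime? p
  ... | yes pr = trans (ν-^ qr (prime>0 pr) k) (trans (cong (k *_) (ν-other qr pr (p≢q ∘ sym))) (*-zeroʳ k))
  ... | no _ = ν-1 qr

  primeProduct : ℕ → (ℕ → ℕ) → ℕ
  primeProduct zero    g = 1
  primeProduct (suc N) g = primeProduct N g * primePower (suc N) (g (suc N))

  primeProduct-pos : ∀ N g → 0 < primeProduct N g
  primeProduct-pos zero    g = z<s
  primeProduct-pos (suc N) g = *-pos (primeProduct-pos N g) (primePower-pos (suc N) (g (suc N)))

  ν-primeProduct : ∀ N g → (∀ p → Prime p → N < p → g p ≡ 0) → ∀ q → Prime q → ν q (primeProduct N g) ≡ g q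
  ν-primeProduct N g g-vanishes q qr = byCases (q ≤? N)
    where
    above : ∀ N → N < q → ν q (primeProduct N g) ≡ 0
    above zero    _   = ν-1 qr
    above (suc N) N<q = begin
      ν q (primeProduct N g * primePower (suc N) _)
        ≡⟨ ν-* qr (primeProduct-pos N g) (primePower-pos (suc N) _) ⟩
      ν q (primeProduct N g) + ν q (primePower (suc N) _)
        ≡⟨ cong₂ _+_ (above N (<-trans (n<1+n N) N<q)) (ν-primePower-other qr (suc N) _ λ N≡q → <-irrefl N≡q N<q) ⟩
      0 ∎
      where open ≡-Reasoning
    below : ∀ N → q ≤ N → ν q (primeProduct N g) ≡ g q
    below zero q≤0 = contradiction (≤-trans (prime>0 qr) q≤0) λ ()
    below (suc N) q≤N with q ≟ suc N
    ... | yes refl = trans (ν-* qr (primeProduct-pos N g) (primePower-pos q _))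
                           (cong₂ _+_ (above N ≤-refl) (ν-primePower-self qr (g q)))
    ... | no q≢N = trans (ν-* qr (primeProduct-pos N g) (primePower-pos (suc N) _))
                         (trans (cong₂ _+_ (below N (≤-pred (≤∧≢⇒< q≤N q≢N))) (ν-primePower-other qr (suc N) _ (q≢N ∘ sym)))
                                (+-identityʳ (g q)))
    byCases : Dec (q ≤ N) → ν q (primeProduct N g) ≡ g q
    byCases (yes q≤N) = below N q≤N
    byCases (no q≰N) = trans (above N (≰⇒> q≰N)) (sym (g-vanishes q qr (≰⇒> q≰N)))

  data Factor : Set where
    plain : ℕ → Factor
    power : ℕ → ℕ → Factor

  base : Factor → ℕ
  base (plain m)   = m
  base (power m _) = m

  value : Factor → ℕ
  value (plain m)   = m
  value (power m k) = m ^ k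

  νFactor : ℕ → Factor → ℕ
  νFactor p (plain m)   = ν p m
  νFactor p (power m k) = k * ν p m

  -- Both folds nest to the left, matching how the products in Ψ and 𝓣₁ are written.
  mulFactors : ℕ → List Factor → ℕ
  mulFactors acc []       = acc
  mulFactors acc (f ∷ fs) = mulFactors (acc * value f) fs

  addValuations : ℕ → ℕ → List Factor → ℕ
  addValuations p acc []       = acc
  addValuations p acc (f ∷ fs) = addValuations p (acc + νFactor p f) fs

  value-pos : ∀ f → 0 < base f → 0 < value f
  value-pos (plain m)   0<m = 0<m
  value-pos (power m k) 0<m = ^-pos k 0<m

  ν-value : ∀ {p} → Prime p → ∀ f → 0 < base f → ν p (value f) ≡ νFactor p f
  ν-value pr (plain m)   _   = refl
  ν-value pr (power m k) 0<m = ν-^ pr 0<m k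

  mulFactors-pos : ∀ {acc} fs → 0 < acc → All (λ f → 0 < base f) fs → 0 < mulFactors acc fs
  mulFactors-pos []       0<acc []            = 0<acc
  mulFactors-pos (f ∷ fs) 0<acc (0<f ∷ 0<fs) = mulFactors-pos fs (*-pos 0<acc (value-pos f 0<f)) 0<fs

  ν-mulFactors : ∀ {p} → Prime p → ∀ {acc} fs → 0 < acc → All (λ f → 0 < base f) fs →
                 ν p (mulFactors acc fs) ≡ addValuations p (ν p acc) fs
  ν-mulFactors pr []       _     []            = refl
  ν-mulFactors {p} pr {acc} (f ∷ fs) 0<acc (0<f ∷ 0<fs) =
    trans (ν-mulFactors pr fs (*-pos 0<acc (value-pos f 0<f)) 0<fs)
          (cong (λ v → addValuations p v fs) (trans (ν-* pr 0<acc (value-pos f 0<f)) (cong (ν p acc +_) (ν-value pr f 0<f))))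

module LocalAnalysis where

  open import Data.Nat.Base
  open import Data.Nat.Properties
  open import Data.Nat.DivMod using (_%_; m*n%n≡0)
  open import Data.Nat.Tactic.RingSolver using (solve; solve-∀)
  open import Data.List.Base using (_∷_; [])
  open import Data.Product.Base using (_×_; _,_)
  open import Data.Sum.Base using (_⊎_; inj₁; inj₂)
  open import Data.Empty using (⊥-elim)
  open import Relation.Nullary using (¬_; contradiction)
  open import Data.Bool.Base using (T)
  open import Relation.Binary.PropositionalEquality
  open import Function.Base using (_∋_)
  open import Relation.Binary.Definitions using (tri<; tri≈; tri>)
  open Valuation using (Disjoint)

  -- The α's and β's are the valuations of the ξ's and τ's at one prime; ψᵢ is then the valuation of
  -- the i-th coordinate of Ψ, and termℓ, term₂, term₁ those of the three terms of the torsor equation.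
  record Exponents : Set where
    constructor exps
    field α₁ α₂ α₃ αℓ α₄ α₅ α₆ β₁ β₂ βℓ : ℕ

  open Exponents public

  ψ₀ ψ₁ ψ₂ ψ₃ : Exponents → ℕ
  ψ₀ a = α₁ a + 2 * α₂ a + 2 * α₃ a + α₄ a + 2 * α₅ a + 3 * α₆ a + β₂ a
  ψ₁ a = βℓ a
  ψ₂ a = 2 * α₁ a + 3 * α₂ a + 4 * α₃ a + 3 * αℓ a + 4 * α₄ a + 5 * α₅ a + 6 * α₆ a
  ψ₃ a = 2 * α₁ a + 2 * α₂ a + 3 * α₃ a + αℓ a + 2 * α₄ a + 3 * α₅ a + 4 * α₆ a + β₁ a

  termℓ term₂ term₁ : Exponents → ℕ
  termℓ a = βℓ a + 3 * αℓ a + 2 * α₄ a + α₅ a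
  term₂ a = 2 * β₂ a + α₂ a
  term₁ a = 3 * β₁ a + 2 * α₁ a + α₃ a

  MinAttainedTwice : ℕ → ℕ → ℕ → Set
  MinAttainedTwice A B C = ¬ (A < B × A < C) × ¬ (B < A × B < C) × ¬ (C < A × C < B)

  TorsorMin : Exponents → Set
  TorsorMin a = MinAttainedTwice (termℓ a) (term₂ a) (term₁ a)

  CurveMin : ℕ → ℕ → ℕ → ℕ → Set
  CurveMin e₀ e₁ e₂ e₃ = MinAttainedTwice (e₁ + 2 * e₂) (e₂ + 2 * e₀) (3 * e₃)

  NotAllPositive : ℕ → ℕ → ℕ → ℕ → Set
  NotAllPositive e₀ e₁ e₂ e₃ = e₀ ≡ 0 ⊎ e₁ ≡ 0 ⊎ e₂ ≡ 0 ⊎ e₃ ≡ 0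

  record Admissible (a : Exponents) : Set where
    field
      squareFree : α₁ a + α₂ a + α₃ a + α₄ a + α₅ a ≤ 1
      coprime₁   : Disjoint (β₁ a) (α₂ a + αℓ a + α₄ a + α₅ a)
      coprime₂   : Disjoint (β₂ a) (α₁ a + α₃ a)
      coprimeℓ   : Disjoint (βℓ a) (α₄ a + α₅ a + α₆ a)

  min-pinsˡ : ∀ {A B C} → A < B → MinAttainedTwice A B C → C ≡ A
  min-pinsˡ {A} {B} {C} A<B (¬A , _ , ¬C) with <-cmp C A
  ... | tri< C<A _ _ = ⊥-elim (¬C (C<A , <-trans C<A A<B))
  ... | tri≈ _ C≡A _ = C≡A
  ... | tri> _ _ A<C = ⊥-elim (¬A (A<B , A<C))

  min-pinsʳ : ∀ {A B C} → B < A → MinAttainedTwice A B C → C ≡ B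
  min-pinsʳ B<A (¬A , ¬B , ¬C) = min-pinsˡ B<A (¬B , ¬A , λ (C<B , C<A) → ¬C (C<A , C<B))

  min-tie : ∀ {A C} → MinAttainedTwice A A C → A ≤ C
  min-tie (_ , _ , ¬C) = ≮⇒≥ λ C<A → ¬C (C<A , C<A)

  min-posᵇ : ∀ {A B C} → MinAttainedTwice A B C → 0 < A → 0 < C → 0 < B
  min-posᵇ {B = zero}  (_ , ¬B , _) 0<A 0<C = ⊥-elim (¬B (0<A , 0<C))
  min-posᵇ {B = suc _} _            _   _   = z<s

  min-posᶜ : ∀ {A B C} → MinAttainedTwice A B C → 0 < A → 0 < B → 0 < C
  min-posᶜ {C = zero}  (_ , _ , ¬C) 0<A 0<B = ⊥-elim (¬C (0<A , 0<B))
  min-posᶜ {C = suc _} _            _   _   = z<s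

  min-shift : ∀ k {A B C} → MinAttainedTwice (k + A) (k + B) (k + C) → MinAttainedTwice A B C
  min-shift k (¬A , ¬B , ¬C) =
    (λ (p , q) → ¬A (+-monoʳ-< k p , +-monoʳ-< k q)) ,
    (λ (p , q) → ¬B (+-monoʳ-< k p , +-monoʳ-< k q)) ,
    (λ (p , q) → ¬C (+-monoʳ-< k p , +-monoʳ-< k q))

  -- The admissible exponent patterns, indexed by the resulting valuations of the coordinates of Ψ.
  -- A base constructor names the ξ divisible by p (ξ₁ … ξ₅ are jointly squarefree), and with-ξ₆ adds
  -- one factor p to ξ₆.
  data LocalSolution : ℕ → ℕ → ℕ → ℕ → Set where
    at-none : ∀ b₂ bℓ b₁ → LocalSolution b₂ bℓ 0 b₁
    at-ξℓ   : ∀ aℓ bℓ → LocalSolution 0 bℓ (3 * aℓ) aℓ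
    at-ξ₁   : ∀ b₁ → LocalSolution 1 0 2 (2 + b₁)
    at-ξ₄   : ∀ aℓ → LocalSolution 1 0 (4 + 3 * aℓ) (2 + aℓ)
    at-ξ₂   : ∀ b₂ → LocalSolution (2 + b₂) 0 3 2
    at-ξ₃   : ∀ b₁ → LocalSolution 2 0 4 (3 + b₁)
    at-ξ₅   : ∀ aℓ → LocalSolution 2 0 (5 + 3 * aℓ) (3 + aℓ)
    with-ξ₆ : ∀ {e₀ e₂ e₃} → LocalSolution e₀ 0 e₂ e₃ → LocalSolution (3 + e₀) 0 (6 + e₂) (4 + e₃)

  bump₆ : Exponents → Exponents
  bump₆ (exps a₁ a₂ a₃ aℓ a₄ a₅ a₆ b₁ b₂ bℓ) = exps a₁ a₂ a₃ aℓ a₄ a₅ (suc a₆) b₁ b₂ bℓ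

  exponents : ∀ {e₀ e₁ e₂ e₃} → LocalSolution e₀ e₁ e₂ e₃ → Exponents
  exponents (at-none b₂ bℓ b₁) = exps 0 0 0 0  0 0 0 b₁ b₂ bℓ
  exponents (at-ξℓ aℓ bℓ)      = exps 0 0 0 aℓ 0 0 0 0  0  bℓ
  exponents (at-ξ₁ b₁)         = exps 1 0 0 0  0 0 0 b₁ 0  0
  exponents (at-ξ₄ aℓ)         = exps 0 0 0 aℓ 1 0 0 0  0  0
  exponents (at-ξ₂ b₂)         = exps 0 1 0 0  0 0 0 0  b₂ 0
  exponents (at-ξ₃ b₁)         = exps 0 0 1 0  0 0 0 b₁ 0  0
  exponents (at-ξ₅ aℓ)         = exps 0 0 0 aℓ 0 1 0 0  0  0
  exponents (with-ξ₆ s)        = bump₆ (exponents s)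

  record Realises (a : Exponents) (e₀ e₁ e₂ e₃ : ℕ) : Set where
    field
      ψ₀≡ : ψ₀ a ≡ e₀
      ψ₁≡ : ψ₁ a ≡ e₁
      ψ₂≡ : ψ₂ a ≡ e₂
      ψ₃≡ : ψ₃ a ≡ e₃
      admissible : Admissible a

  open Realises public

  ψ₀-bump₆ : ∀ a → ψ₀ (bump₆ a) ≡ 3 + ψ₀ a
  ψ₀-bump₆ (exps a₁ a₂ a₃ aℓ a₄ a₅ a₆ b₁ b₂ bℓ) = lemma (a₁ + 2 * a₂ + 2 * a₃ + a₄ + 2 * a₅) a₆ b₂
    where
    lemma : ∀ x y z → x + 3 * suc y + z ≡ 3 + (x + 3 * y + z)
    lemma = solve-∀

  ψ₂-bump₆ : ∀ a → ψ₂ (bump₆ a) ≡ 6 + ψ₂ a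
  ψ₂-bump₆ (exps a₁ a₂ a₃ aℓ a₄ a₅ a₆ b₁ b₂ bℓ) = lemma (2 * a₁ + 3 * a₂ + 4 * a₃ + 3 * aℓ + 4 * a₄ + 5 * a₅) a₆
    where
    lemma : ∀ x y → x + 6 * suc y ≡ 6 + (x + 6 * y)
    lemma = solve-∀

  ψ₃-bump₆ : ∀ a → ψ₃ (bump₆ a) ≡ 4 + ψ₃ a
  ψ₃-bump₆ (exps a₁ a₂ a₃ aℓ a₄ a₅ a₆ b₁ b₂ bℓ) = lemma (2 * a₁ + 2 * a₂ + 3 * a₃ + aℓ + 2 * a₄ + 3 * a₅) a₆ b₁
    where
    lemma : ∀ x y z → x + 4 * suc y + z ≡ 4 + (x + 4 * y + z)
    lemma = solve-∀

  exponents-realise : ∀ {e₀ e₁ e₂ e₃} (s : LocalSolution e₀ e₁ e₂ e₃) → Realises (exponents s) e₀ e₁ e₂ e₃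
  exponents-realise (at-none b₂ bℓ b₁) = record
    { ψ₀≡ = refl ; ψ₁≡ = refl ; ψ₂≡ = refl ; ψ₃≡ = refl
    ; admissible = record { squareFree = z≤n ; coprime₁ = inj₂ refl ; coprime₂ = inj₂ refl ; coprimeℓ = inj₂ refl } }
  exponents-realise (at-ξℓ aℓ bℓ) = record
    { ψ₀≡ = refl ; ψ₁≡ = refl ; ψ₂≡ = (3 * aℓ + 0 + 0 + 0 ≡ 3 * aℓ) ∋ solve (aℓ ∷ [])
    ; ψ₃≡ = (aℓ + 0 + 0 + 0 + 0 ≡ aℓ) ∋ solve (aℓ ∷ [])
    ; admissible = record { squareFree = z≤n ; coprime₁ = inj₁ refl ; coprime₂ = inj₁ refl ; coprimeℓ = inj₂ refl } }
  exponents-realise (at-ξ₁ b₁) = record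
    { ψ₀≡ = refl ; ψ₁≡ = refl ; ψ₂≡ = refl ; ψ₃≡ = refl
    ; admissible = record { squareFree = ≤-refl ; coprime₁ = inj₂ refl ; coprime₂ = inj₁ refl ; coprimeℓ = inj₁ refl } }
  exponents-realise (at-ξ₄ aℓ) = record
    { ψ₀≡ = refl ; ψ₁≡ = refl ; ψ₂≡ = (3 * aℓ + 4 + 0 + 0 ≡ 4 + 3 * aℓ) ∋ solve (aℓ ∷ [])
    ; ψ₃≡ = (aℓ + 2 + 0 + 0 + 0 ≡ 2 + aℓ) ∋ solve (aℓ ∷ [])
    ; admissible = record { squareFree = ≤-refl ; coprime₁ = inj₁ refl ; coprime₂ = inj₁ refl ; coprimeℓ = inj₁ refl } }
  exponents-realise (at-ξ₂ b₂) = record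
    { ψ₀≡ = refl ; ψ₁≡ = refl ; ψ₂≡ = refl ; ψ₃≡ = refl
    ; admissible = record { squareFree = ≤-refl ; coprime₁ = inj₁ refl ; coprime₂ = inj₂ refl ; coprimeℓ = inj₁ refl } }
  exponents-realise (at-ξ₃ b₁) = record
    { ψ₀≡ = refl ; ψ₁≡ = refl ; ψ₂≡ = refl ; ψ₃≡ = refl
    ; admissible = record { squareFree = ≤-refl ; coprime₁ = inj₂ refl ; coprime₂ = inj₁ refl ; coprimeℓ = inj₁ refl } }
  exponents-realise (at-ξ₅ aℓ) = record
    { ψ₀≡ = refl ; ψ₁≡ = refl ; ψ₂≡ = (3 * aℓ + 0 + 5 + 0 ≡ 5 + 3 * aℓ) ∋ solve (aℓ ∷ [])
    ; ψ₃≡ = (aℓ + 0 + 3 + 0 + 0 ≡ 3 + aℓ) ∋ solve (aℓ ∷ [])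
    ; admissible = record { squareFree = ≤-refl ; coprime₁ = inj₁ refl ; coprime₂ = inj₁ refl ; coprimeℓ = inj₁ refl } }
  exponents-realise (with-ξ₆ s) = record
    { ψ₀≡ = trans (ψ₀-bump₆ a) (cong (3 +_) (ψ₀≡ r))
    ; ψ₁≡ = ψ₁≡ r
    ; ψ₂≡ = trans (ψ₂-bump₆ a) (cong (6 +_) (ψ₂≡ r))
    ; ψ₃≡ = trans (ψ₃-bump₆ a) (cong (4 +_) (ψ₃≡ r))
    ; admissible = record { Admissible (admissible r) ; coprimeℓ = inj₁ (ψ₁≡ r) } }
    where
    a = exponents s
    r = exponents-realise s

  min-cong : ∀ {A B C A′ B′ C′} → A ≡ A′ → B ≡ B′ → C ≡ C′ → MinAttainedTwice A B C → MinAttainedTwice A′ B′ C′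
  min-cong refl refl refl m = m

  decide-< : ∀ m n → {T (m <ᵇ n)} → m < n
  decide-< m n {m<n} = <ᵇ⇒< m n m<n

  3*k≡n⇒n%3≡0 : ∀ k {n} → 3 * k ≡ n → n % 3 ≡ 0
  3*k≡n⇒n%3≡0 k refl = trans (cong (_% 3) (*-comm 3 k)) (m*n%n≡0 k 3)

  n+k<e+2*n : ∀ e {k n} → k < n → n + k < e + 2 * n
  n+k<e+2*n e {k} {n} k<n = begin-strict
    n + k       <⟨ +-monoʳ-< n k<n ⟩
    n + n       ≡⟨ cong (n +_) (+-identityʳ n) ⟨
    2 * n       ≤⟨ m≤n+m (2 * n) e ⟩
    e + 2 * n   ∎
    where open ≤-Reasoning

  2*n<n+2*[3+k] : ∀ n k → n < 6 → 2 * n < n + 2 * (3 + k)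
  2*n<n+2*[3+k] n k n<6 = begin-strict
    2 * n            ≡⟨ cong (n +_) (+-identityʳ n) ⟩
    n + n            <⟨ +-monoʳ-< n (<-≤-trans n<6 (m≤m+n 6 (2 * k))) ⟩
    n + (6 + 2 * k)  ≡⟨ cong (n +_) (*-distribˡ-+ 2 3 k) ⟨
    n + 2 * (3 + k)  ∎
    where open ≤-Reasoning

  ¬minTwice-below12 : ∀ n {A B} → {T (n <ᵇ 12)} → ¬ MinAttainedTwice (12 + A) (12 + B) n
  ¬minTwice-below12 n {A} {B} {n<12} (_ , _ , ¬C) =
    ¬C (<-≤-trans (decide-< n 12 {n<12}) (m≤m+n 12 A) , <-≤-trans (decide-< n 12 {n<12}) (m≤m+n 12 B))

  mutual
    localSolution : ∀ e₀ e₁ e₂ e₃ → NotAllPositive e₀ e₁ e₂ e₃ → CurveMin e₀ e₁ e₂ e₃ → LocalSolution e₀ e₁ e₂ e₃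
    localSolution e₀ e₁ 0 e₃ _ _ = at-none e₀ e₁ e₃
    localSolution 0 e₁ e₂@(suc _) e₃ _ m = subst (λ e → LocalSolution 0 e₁ e e₃) 3e₃≡e₂ (at-ξℓ e₃ e₁)
      where
      3e₃≡e₂ : 3 * e₃ ≡ e₂
      3e₃≡e₂ = trans (min-pinsʳ (n+k<e+2*n e₁ z<s) m) (+-identityʳ e₂)
    localSolution (suc _) e₁ (suc c) 0 _ (_ , _ , ¬C) = ⊥-elim (¬C (<-≤-trans z<s (m≤n+m (2 * suc c) e₁) , z<s))
    localSolution (suc _) (suc _) (suc _) (suc _) (inj₁ ()) _
    localSolution (suc _) (suc _) (suc _) (suc _) (inj₂ (inj₁ ())) _
    localSolution (suc _) (suc _) (suc _) (suc _) (inj₂ (inj₂ (inj₁ ()))) _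
    localSolution (suc _) (suc _) (suc _) (suc _) (inj₂ (inj₂ (inj₂ ()))) _
    localSolution 1 0 e₂@(suc _) e₃@(suc _) _ m = localSolution₁ e₂ e₃ m
    localSolution 2 0 e₂@(suc _) e₃@(suc _) _ m = localSolution₂ e₂ e₃ m
    localSolution (suc (suc (suc k))) 0 e₂@(suc _) e₃@(suc _) _ m = localSolution₃₊ k e₂ e₃ m

    localSolution₁ : ∀ e₂ e₃ → CurveMin 1 0 e₂ e₃ → LocalSolution 1 0 e₂ e₃
    localSolution₁ 0 e₃ _ = at-none 1 0 e₃
    localSolution₁ 1 e₃ m = contradiction (3*k≡n⇒n%3≡0 e₃ (min-pinsˡ (decide-< 2 3) m)) λ ()
    localSolution₁ 2 0 m = contradiction (min-tie m) (<⇒≱ (decide-< 0 4))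
    localSolution₁ 2 1 m = contradiction (min-tie m) (<⇒≱ (decide-< 3 4))
    localSolution₁ 2 (suc (suc b₁)) _ = at-ξ₁ b₁
    localSolution₁ (suc (suc (suc c))) e₃ m
      with trans (min-pinsʳ (n+k<e+2*n 0 (m≤m+n 3 c)) m) (cong (3 +_) (+-comm c 2))
    ... | 3e₃≡5+c with e₃
    ...   | 0 = contradiction 3e₃≡5+c λ ()
    ...   | 1 = contradiction 3e₃≡5+c λ ()
    ...   | suc (suc aℓ) with trans (sym (*-distribˡ-+ 3 2 aℓ)) 3e₃≡5+c
    ...     | refl = at-ξ₄ aℓ

    localSolution₂ : ∀ e₂ e₃ → CurveMin 2 0 e₂ e₃ → LocalSolution 2 0 e₂ e₃
    localSolution₂ 0 e₃ _ = at-none 2 0 e₃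
    localSolution₂ 1 e₃ m = contradiction (3*k≡n⇒n%3≡0 e₃ (min-pinsˡ (decide-< 2 5) m)) λ ()
    localSolution₂ 2 e₃ m = contradiction (3*k≡n⇒n%3≡0 e₃ (min-pinsˡ (decide-< 4 6) m)) λ ()
    localSolution₂ 3 e₃ m with *-cancelˡ-≡ e₃ 2 3 (min-pinsˡ (decide-< 6 7) m)
    ... | refl = at-ξ₂ 0
    localSolution₂ 4 0 m = contradiction (min-tie m) (<⇒≱ (decide-< 0 8))
    localSolution₂ 4 1 m = contradiction (min-tie m) (<⇒≱ (decide-< 3 8))
    localSolution₂ 4 2 m = contradiction (min-tie m) (<⇒≱ (decide-< 6 8))
    localSolution₂ 4 (suc (suc (suc b₁))) _ = at-ξ₃ b₁
    localSolution₂ (suc (suc (suc (suc (suc c))))) e₃ m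
      with trans (min-pinsʳ (n+k<e+2*n 0 (m≤m+n 5 c)) m) (cong (5 +_) (+-comm c 4))
    ... | 3e₃≡9+c with e₃
    ...   | 0 = contradiction 3e₃≡9+c λ ()
    ...   | 1 = contradiction 3e₃≡9+c λ ()
    ...   | 2 = contradiction 3e₃≡9+c λ ()
    ...   | suc (suc (suc aℓ)) with trans (sym (*-distribˡ-+ 3 3 aℓ)) 3e₃≡9+c
    ...     | refl = at-ξ₅ aℓ

    localSolution₃₊ : ∀ k e₂ e₃ → CurveMin (3 + k) 0 e₂ e₃ → LocalSolution (3 + k) 0 e₂ e₃
    localSolution₃₊ k 0 e₃ _ = at-none (3 + k) 0 e₃
    localSolution₃₊ k 1 e₃ m = contradiction (3*k≡n⇒n%3≡0 e₃ (min-pinsˡ (2*n<n+2*[3+k] 1 k (decide-< 1 6)) m)) λ ()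
    localSolution₃₊ k 2 e₃ m = contradiction (3*k≡n⇒n%3≡0 e₃ (min-pinsˡ (2*n<n+2*[3+k] 2 k (decide-< 2 6)) m)) λ ()
    localSolution₃₊ k 3 e₃ m with *-cancelˡ-≡ e₃ 2 3 (min-pinsˡ (2*n<n+2*[3+k] 3 k (decide-< 3 6)) m)
    ... | refl = at-ξ₂ (suc k)
    localSolution₃₊ k 4 e₃ m = contradiction (3*k≡n⇒n%3≡0 e₃ (min-pinsˡ (2*n<n+2*[3+k] 4 k (decide-< 4 6)) m)) λ ()
    localSolution₃₊ k 5 e₃ m = contradiction (3*k≡n⇒n%3≡0 e₃ (min-pinsˡ (2*n<n+2*[3+k] 5 k (decide-< 5 6)) m)) λ ()
    localSolution₃₊ k (suc (suc (suc (suc (suc (suc c)))))) e₃ m =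
      descend k c e₃ (min-cong (*-distribˡ-+ 2 6 c) (6+c+2*[3+k] c k) refl m)
      where
      6+c+2*[3+k] : ∀ c k → (6 + c) + 2 * (3 + k) ≡ 12 + (c + 2 * k)
      6+c+2*[3+k] = solve-∀

    -- All three monomials of the curve equation are divisible by p¹²; removing it undoes one with-ξ₆.
    descend : ∀ k c e₃ → MinAttainedTwice (12 + 2 * c) (12 + (c + 2 * k)) (3 * e₃) → LocalSolution (3 + k) 0 (6 + c) e₃
    descend k c 0 m = ⊥-elim (¬minTwice-below12 0 m)
    descend k c 1 m = ⊥-elim (¬minTwice-below12 3 m)
    descend k c 2 m = ⊥-elim (¬minTwice-below12 6 m)
    descend k c 3 m = ⊥-elim (¬minTwice-below12 9 m)
    descend k c (suc (suc (suc (suc j)))) m =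
      with-ξ₆ (localSolution k 0 c j (inj₂ (inj₁ refl)) (min-shift 12 (min-cong refl refl (*-distribˡ-+ 3 4 j) m)))

  -- Inverse of ψ on admissible patterns (decode-ψ); elsewhere the truncated subtractions give junk.
  decode : ℕ → ℕ → ℕ → ℕ → Exponents
  decode e₀ e₁ 0 e₃                      = exps 0 0 0 0 0 0 0 e₃ e₀ e₁
  decode 0 e₁ _ e₃                       = exps 0 0 0 e₃ 0 0 0 0 0 e₁
  decode 1 _ 2 e₃                        = exps 1 0 0 0 0 0 0 (e₃ ∸ 2) 0 0
  decode 1 _ _ e₃                        = exps 0 0 0 (e₃ ∸ 2) 1 0 0 0 0 0
  decode (suc (suc b₂)) _ 3 _            = exps 0 1 0 0 0 0 0 0 b₂ 0
  decode 2 _ 4 e₃                        = exps 0 0 1 0 0 0 0 (e₃ ∸ 3) 0 0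
  decode 2 _ _ e₃                        = exps 0 0 0 (e₃ ∸ 3) 0 1 0 0 0 0
  decode (suc (suc (suc e₀))) _ e₂ e₃    = bump₆ (decode e₀ 0 (e₂ ∸ 6) (e₃ ∸ 4))

  exponents≡decode : ∀ {e₀ e₁ e₂ e₃} (s : LocalSolution e₀ e₁ e₂ e₃) → exponents s ≡ decode e₀ e₁ e₂ e₃
  exponents≡decode (at-none _ _ _)    = refl
  exponents≡decode (at-ξℓ zero _)     = refl
  exponents≡decode (at-ξℓ (suc _) _)  = refl
  exponents≡decode (at-ξ₁ _)          = refl
  exponents≡decode (at-ξ₄ _)          = refl
  exponents≡decode (at-ξ₂ _)          = refl
  exponents≡decode (at-ξ₃ _)          = refl
  exponents≡decode (at-ξ₅ _)          = refl
  exponents≡decode (with-ξ₆ s)        = cong bump₆ (exponents≡decode s)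

  solution-notAllPositive : ∀ {e₀ e₁ e₂ e₃} → LocalSolution e₀ e₁ e₂ e₃ → NotAllPositive e₀ e₁ e₂ e₃
  solution-notAllPositive (at-none _ _ _) = inj₂ (inj₂ (inj₁ refl))
  solution-notAllPositive (at-ξℓ _ _)     = inj₁ refl
  solution-notAllPositive (at-ξ₁ _)       = inj₂ (inj₁ refl)
  solution-notAllPositive (at-ξ₄ _)       = inj₂ (inj₁ refl)
  solution-notAllPositive (at-ξ₂ _)       = inj₂ (inj₁ refl)
  solution-notAllPositive (at-ξ₃ _)       = inj₂ (inj₁ refl)
  solution-notAllPositive (at-ξ₅ _)       = inj₂ (inj₁ refl)
  solution-notAllPositive (with-ξ₆ _)     = inj₂ (inj₁ refl)

  +-posʳ : ∀ m {n} → 0 < n → 0 < m + n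
  +-posʳ m {n} 0<n = <-≤-trans 0<n (m≤n+m n m)

  +-posˡ : ∀ {m} n → 0 < m → 0 < m + n
  +-posˡ {m} n 0<m = <-≤-trans 0<m (m≤m+n m n)

  ¬disjoint : ∀ {m n} → 0 < m → 0 < n → ¬ Disjoint m n
  ¬disjoint 0<m _ (inj₁ refl) = <-irrefl refl 0<m
  ¬disjoint _ 0<n (inj₂ refl) = <-irrefl refl 0<n

  record FromSolution (a : Exponents) : Set where
    constructor fromSolution
    field
      {e₀ e₁ e₂ e₃} : ℕ
      solution      : LocalSolution e₀ e₁ e₂ e₃
      exponents≡    : exponents solution ≡ a

  open Admissible

  classify₀ : ∀ a₁ a₂ a₃ aℓ a₄ a₅ b₁ b₂ bℓ → let a = exps a₁ a₂ a₃ aℓ a₄ a₅ 0 b₁ b₂ bℓ in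
              Admissible a → TorsorMin a → FromSolution a
  classify₀ (suc (suc _)) _ _ _ _ _ _ _ _ record { squareFree = s≤s () } _
  classify₀ 1 (suc _) _ _ _ _ _ _ _ record { squareFree = s≤s () } _
  classify₀ 1 0 (suc _) _ _ _ _ _ _ record { squareFree = s≤s () } _
  classify₀ 1 0 0 _ (suc _) _ _ _ _ record { squareFree = s≤s () } _
  classify₀ 1 0 0 _ 0 (suc _) _ _ _ record { squareFree = s≤s () } _
  classify₀ 0 (suc (suc _)) _ _ _ _ _ _ _ record { squareFree = s≤s () } _
  classify₀ 0 1 (suc _) _ _ _ _ _ _ record { squareFree = s≤s () } _
  classify₀ 0 1 0 _ (suc _) _ _ _ _ record { squareFree = s≤s () } _
  classify₀ 0 1 0 _ 0 (suc _) _ _ _ record { squareFree = s≤s () } _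
  classify₀ 0 0 (suc (suc _)) _ _ _ _ _ _ record { squareFree = s≤s () } _
  classify₀ 0 0 1 _ (suc _) _ _ _ _ record { squareFree = s≤s () } _
  classify₀ 0 0 1 _ 0 (suc _) _ _ _ record { squareFree = s≤s () } _
  classify₀ 0 0 0 _ (suc (suc _)) _ _ _ _ record { squareFree = s≤s () } _
  classify₀ 0 0 0 _ 1 (suc _) _ _ _ record { squareFree = s≤s () } _
  classify₀ 0 0 0 _ 0 (suc (suc _)) _ _ _ record { squareFree = s≤s () } _
  classify₀ 0 0 0 0 0 0 b₁ b₂ bℓ _ _ = fromSolution (at-none b₂ bℓ b₁) refl
  classify₀ 0 0 0 (suc aℓ) 0 0 (suc b₁) b₂ bℓ adm _ = ⊥-elim (¬disjoint z<s z<s (coprime₁ adm))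
  classify₀ 0 0 0 (suc aℓ) 0 0 0 (suc b₂) bℓ _ m =
    contradiction (min-posᶜ m (+-posˡ 0 (+-posˡ 0 (+-posʳ bℓ z<s))) z<s) λ ()
  classify₀ 0 0 0 (suc aℓ) 0 0 0 0 bℓ _ _ = fromSolution (at-ξℓ (suc aℓ) bℓ) refl
  classify₀ 1 0 0 aℓ 0 0 b₁ (suc b₂) bℓ adm _ = ⊥-elim (¬disjoint z<s z<s (coprime₂ adm))
  classify₀ 1 0 0 aℓ 0 0 b₁ 0 (suc bℓ) _ m =
    contradiction (min-posᵇ m z<s (+-posˡ 0 (+-posʳ (3 * b₁) z<s))) λ ()
  classify₀ 1 0 0 (suc aℓ) 0 0 b₁ 0 0 _ m =
    contradiction (min-posᵇ m z<s (+-posˡ 0 (+-posʳ (3 * b₁) z<s))) λ ()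
  classify₀ 1 0 0 0 0 0 b₁ 0 0 _ _ = fromSolution (at-ξ₁ b₁) refl
  classify₀ 0 1 0 aℓ 0 0 (suc b₁) b₂ bℓ adm _ = ⊥-elim (¬disjoint z<s z<s (coprime₁ adm))
  classify₀ 0 1 0 aℓ 0 0 0 b₂ (suc bℓ) _ m = contradiction (min-posᶜ m z<s (+-posʳ (2 * b₂) z<s)) λ ()
  classify₀ 0 1 0 (suc aℓ) 0 0 0 b₂ 0 _ m = contradiction (min-posᶜ m z<s (+-posʳ (2 * b₂) z<s)) λ ()
  classify₀ 0 1 0 0 0 0 0 b₂ 0 _ _ = fromSolution (at-ξ₂ b₂) refl
  classify₀ 0 0 1 aℓ 0 0 b₁ (suc b₂) bℓ adm _ = ⊥-elim (¬disjoint z<s z<s (coprime₂ adm))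
  classify₀ 0 0 1 aℓ 0 0 b₁ 0 (suc bℓ) _ m = contradiction (min-posᵇ m z<s (+-posʳ (3 * b₁ + 0) z<s)) λ ()
  classify₀ 0 0 1 (suc aℓ) 0 0 b₁ 0 0 _ m = contradiction (min-posᵇ m z<s (+-posʳ (3 * b₁ + 0) z<s)) λ ()
  classify₀ 0 0 1 0 0 0 b₁ 0 0 _ _ = fromSolution (at-ξ₃ b₁) refl
  classify₀ 0 0 0 aℓ 1 0 (suc b₁) b₂ bℓ adm _ = ⊥-elim (¬disjoint z<s (+-posˡ 0 (+-posʳ aℓ z<s)) (coprime₁ adm))
  classify₀ 0 0 0 aℓ 1 0 0 b₂ (suc bℓ) adm _ = ⊥-elim (¬disjoint z<s z<s (coprimeℓ adm))
  classify₀ 0 0 0 aℓ 1 0 0 (suc b₂) 0 _ m =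
    contradiction (min-posᶜ m (+-posˡ 0 (+-posʳ (3 * aℓ) z<s)) z<s) λ ()
  classify₀ 0 0 0 aℓ 1 0 0 0 0 _ _ = fromSolution (at-ξ₄ aℓ) refl
  classify₀ 0 0 0 aℓ 0 1 (suc b₁) b₂ bℓ adm _ = ⊥-elim (¬disjoint z<s (+-posʳ (aℓ + 0) z<s) (coprime₁ adm))
  classify₀ 0 0 0 aℓ 0 1 0 b₂ (suc bℓ) adm _ = ⊥-elim (¬disjoint z<s z<s (coprimeℓ adm))
  classify₀ 0 0 0 aℓ 0 1 0 (suc b₂) 0 _ m = contradiction (min-posᶜ m (+-posʳ (3 * aℓ + 0) z<s) z<s) λ ()
  classify₀ 0 0 0 aℓ 0 1 0 0 0 _ _ = fromSolution (at-ξ₅ aℓ) refl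

  classify : ∀ a → Admissible a → TorsorMin a → FromSolution a
  classify (exps a₁ a₂ a₃ aℓ a₄ a₅ (suc a₆) b₁ b₂ (suc bℓ)) adm _ =
    ⊥-elim (¬disjoint z<s (+-posʳ (a₄ + a₅) z<s) (coprimeℓ adm))
  classify (exps a₁ a₂ a₃ aℓ a₄ a₅ (suc a₆) b₁ b₂ 0) adm m
    with classify (exps a₁ a₂ a₃ aℓ a₄ a₅ a₆ b₁ b₂ 0) (record { Admissible adm ; coprimeℓ = inj₁ refl }) m
  ... | fromSolution s exponents≡ with trans (sym (ψ₁≡ (exponents-realise s))) (cong ψ₁ exponents≡)
  ...   | refl = fromSolution (with-ξ₆ s) (cong bump₆ exponents≡)
  classify (exps a₁ a₂ a₃ aℓ a₄ a₅ 0 b₁ b₂ bℓ) = classify₀ a₁ a₂ a₃ aℓ a₄ a₅ b₁ b₂ bℓ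

  realises-subst : ∀ (P : ℕ → ℕ → ℕ → ℕ → Set) {a e₀ e₁ e₂ e₃} → Realises a e₀ e₁ e₂ e₃ →
                   P (ψ₀ a) (ψ₁ a) (ψ₂ a) (ψ₃ a) → P e₀ e₁ e₂ e₃
  realises-subst P record { ψ₀≡ = refl ; ψ₁≡ = refl ; ψ₂≡ = refl ; ψ₃≡ = refl } Pψ = Pψ

  realises-subst⁻ : ∀ (P : ℕ → ℕ → ℕ → ℕ → Set) {a e₀ e₁ e₂ e₃} → Realises a e₀ e₁ e₂ e₃ →
                    P e₀ e₁ e₂ e₃ → P (ψ₀ a) (ψ₁ a) (ψ₂ a) (ψ₃ a)
  realises-subst⁻ P record { ψ₀≡ = refl ; ψ₁≡ = refl ; ψ₂≡ = refl ; ψ₃≡ = refl } Pe = Pe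

  decode-cong-ψ : ∀ {a e₀ e₁ e₂ e₃} → Realises a e₀ e₁ e₂ e₃ → decode (ψ₀ a) (ψ₁ a) (ψ₂ a) (ψ₃ a) ≡ decode e₀ e₁ e₂ e₃
  decode-cong-ψ {a} r = realises-subst (λ e₀ e₁ e₂ e₃ → decode (ψ₀ a) (ψ₁ a) (ψ₂ a) (ψ₃ a) ≡ decode e₀ e₁ e₂ e₃) r refl

  decode-ψ : ∀ a → Admissible a → TorsorMin a → decode (ψ₀ a) (ψ₁ a) (ψ₂ a) (ψ₃ a) ≡ a
  decode-ψ a adm m with classify a adm m
  ... | fromSolution s refl = trans (decode-cong-ψ (exponents-realise s)) (sym (exponents≡decode s))

  ψ-notAllPositive : ∀ a → Admissible a → TorsorMin a → NotAllPositive (ψ₀ a) (ψ₁ a) (ψ₂ a) (ψ₃ a)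
  ψ-notAllPositive a adm m with classify a adm m
  ... | fromSolution s refl = realises-subst⁻ NotAllPositive (exponents-realise s) (solution-notAllPositive s)

  decode-realises : ∀ e₀ e₁ e₂ e₃ → NotAllPositive e₀ e₁ e₂ e₃ → CurveMin e₀ e₁ e₂ e₃ →
                    Realises (decode e₀ e₁ e₂ e₃) e₀ e₁ e₂ e₃
  decode-realises e₀ e₁ e₂ e₃ nap m =
    subst (λ a → Realises a e₀ e₁ e₂ e₃) (exponents≡decode s) (exponents-realise s)
    where s = localSolution e₀ e₁ e₂ e₃ nap m

  notAllPositive? : ∀ e₀ e₁ e₂ e₃ → NotAllPositive e₀ e₁ e₂ e₃ ⊎ (0 < e₀ × 0 < e₁ × 0 < e₂ × 0 < e₃)
  notAllPositive? zero    _       _       _       = inj₁ (inj₁ refl)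
  notAllPositive? (suc _) zero    _       _       = inj₁ (inj₂ (inj₁ refl))
  notAllPositive? (suc _) (suc _) zero    _       = inj₁ (inj₂ (inj₂ (inj₁ refl)))
  notAllPositive? (suc _) (suc _) (suc _) zero    = inj₁ (inj₂ (inj₂ (inj₂ refl)))
  notAllPositive? (suc _) (suc _) (suc _) (suc _) = inj₂ (z<s , z<s , z<s , z<s)

  notAllPositive⇒¬allPositive : ∀ {e₀ e₁ e₂ e₃} → NotAllPositive e₀ e₁ e₂ e₃ → ¬ (0 < e₀ × 0 < e₁ × 0 < e₂ × 0 < e₃)
  notAllPositive⇒¬allPositive (inj₁ refl)                 (() , _ , _ , _)
  notAllPositive⇒¬allPositive (inj₂ (inj₁ refl))          (_ , () , _ , _)
  notAllPositive⇒¬allPositive (inj₂ (inj₂ (inj₁ refl)))   (_ , _ , () , _)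
  notAllPositive⇒¬allPositive (inj₂ (inj₂ (inj₂ refl)))   (_ , _ , _ , ())

module CurveIdentity where

  open import Data.Nat.Base as ℕ using (ℕ; zero; suc)
  import Data.Nat.Properties as ℕ
  import Data.Nat.Tactic.RingSolver as ℕ-Solver
  open import Data.Integer.Base
  open import Data.Integer.Properties using (pos-*)
  import Data.Integer.Tactic.RingSolver as ℤ-Solver
  open import Relation.Binary.PropositionalEquality

  module Monomial (y₁ y₂ y₃ yℓ y₄ y₅ y₆ : ℕ) where

    monomial : ℕ → ℕ → ℕ → ℕ → ℕ → ℕ → ℕ → ℕ
    monomial k₁ k₂ k₃ kℓ k₄ k₅ k₆ =
      y₁ ℕ.^ k₁ ℕ.* y₂ ℕ.^ k₂ ℕ.* y₃ ℕ.^ k₃ ℕ.* yℓ ℕ.^ kℓ ℕ.* y₄ ℕ.^ k₄ ℕ.* y₅ ℕ.^ k₅ ℕ.* y₆ ℕ.^ k₆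

    monomial-* : ∀ k₁ k₂ k₃ kℓ k₄ k₅ k₆ j₁ j₂ j₃ jℓ j₄ j₅ j₆ →
      monomial k₁ k₂ k₃ kℓ k₄ k₅ k₆ ℕ.* monomial j₁ j₂ j₃ jℓ j₄ j₅ j₆
      ≡ monomial (k₁ ℕ.+ j₁) (k₂ ℕ.+ j₂) (k₃ ℕ.+ j₃) (kℓ ℕ.+ jℓ) (k₄ ℕ.+ j₄) (k₅ ℕ.+ j₅) (k₆ ℕ.+ j₆)
    monomial-* k₁ k₂ k₃ kℓ k₄ k₅ k₆ j₁ j₂ j₃ jℓ j₄ j₅ j₆ = begin
      monomial k₁ k₂ k₃ kℓ k₄ k₅ k₆ ℕ.* monomial j₁ j₂ j₃ jℓ j₄ j₅ j₆
        ≡⟨ interleave (y₁ ℕ.^ k₁) (y₂ ℕ.^ k₂) (y₃ ℕ.^ k₃) (yℓ ℕ.^ kℓ) (y₄ ℕ.^ k₄) (y₅ ℕ.^ k₅) (y₆ ℕ.^ k₆)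
                      (y₁ ℕ.^ j₁) (y₂ ℕ.^ j₂) (y₃ ℕ.^ j₃) (yℓ ℕ.^ jℓ) (y₄ ℕ.^ j₄) (y₅ ℕ.^ j₅) (y₆ ℕ.^ j₆) ⟩
      (y₁ ℕ.^ k₁ ℕ.* y₁ ℕ.^ j₁) ℕ.* (y₂ ℕ.^ k₂ ℕ.* y₂ ℕ.^ j₂) ℕ.* (y₃ ℕ.^ k₃ ℕ.* y₃ ℕ.^ j₃) ℕ.* (yℓ ℕ.^ kℓ ℕ.* yℓ ℕ.^ jℓ)
        ℕ.* (y₄ ℕ.^ k₄ ℕ.* y₄ ℕ.^ j₄) ℕ.* (y₅ ℕ.^ k₅ ℕ.* y₅ ℕ.^ j₅) ℕ.* (y₆ ℕ.^ k₆ ℕ.* y₆ ℕ.^ j₆)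
        ≡⟨ cong₂ ℕ._*_ (cong₂ ℕ._*_ (cong₂ ℕ._*_ (cong₂ ℕ._*_ (cong₂ ℕ._*_ (cong₂ ℕ._*_
             (^+ y₁ k₁ j₁) (^+ y₂ k₂ j₂)) (^+ y₃ k₃ j₃)) (^+ yℓ kℓ jℓ)) (^+ y₄ k₄ j₄)) (^+ y₅ k₅ j₅)) (^+ y₆ k₆ j₆) ⟩
      monomial (k₁ ℕ.+ j₁) (k₂ ℕ.+ j₂) (k₃ ℕ.+ j₃) (kℓ ℕ.+ jℓ) (k₄ ℕ.+ j₄) (k₅ ℕ.+ j₅) (k₆ ℕ.+ j₆) ∎
      where
      open ≡-Reasoning
      ^+ : ∀ y k j → y ℕ.^ k ℕ.* y ℕ.^ j ≡ y ℕ.^ (k ℕ.+ j)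
      ^+ y k j = sym (ℕ.^-distribˡ-+-* y k j)
      interleave : ∀ a₁ a₂ a₃ a₄ a₅ a₆ a₇ b₁ b₂ b₃ b₄ b₅ b₆ b₇ →
        (a₁ ℕ.* a₂ ℕ.* a₃ ℕ.* a₄ ℕ.* a₅ ℕ.* a₆ ℕ.* a₇) ℕ.* (b₁ ℕ.* b₂ ℕ.* b₃ ℕ.* b₄ ℕ.* b₅ ℕ.* b₆ ℕ.* b₇)
        ≡ (a₁ ℕ.* b₁) ℕ.* (a₂ ℕ.* b₂) ℕ.* (a₃ ℕ.* b₃) ℕ.* (a₄ ℕ.* b₄) ℕ.* (a₅ ℕ.* b₅) ℕ.* (a₆ ℕ.* b₆) ℕ.* (a₇ ℕ.* b₇)
      interleave = ℕ-Solver.solve-∀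

    cofactor : ℕ
    cofactor = monomial 4 6 8 3 6 9 12

    σ κ ρ : ℕ
    σ = monomial 2 3 4 3 4 5 6
    κ = y₁ ℕ.* y₂ ℕ.^ 2 ℕ.* y₃ ℕ.^ 2 ℕ.* y₄ ℕ.* y₅ ℕ.^ 2 ℕ.* y₆ ℕ.^ 3
    ρ = y₁ ℕ.^ 2 ℕ.* y₂ ℕ.^ 2 ℕ.* y₃ ℕ.^ 3 ℕ.* yℓ ℕ.* y₄ ℕ.^ 2 ℕ.* y₅ ℕ.^ 3 ℕ.* y₆ ℕ.^ 4

    κ≡monomial : κ ≡ monomial 1 2 2 0 1 2 3
    κ≡monomial = lemma y₁ (y₂ ℕ.^ 2) (y₃ ℕ.^ 2) y₄ (y₅ ℕ.^ 2) (y₆ ℕ.^ 3)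
      where
      lemma : ∀ a b c d e f → a ℕ.* b ℕ.* c ℕ.* d ℕ.* e ℕ.* f ≡ a ℕ.* 1 ℕ.* b ℕ.* c ℕ.* 1 ℕ.* (d ℕ.* 1) ℕ.* e ℕ.* f
      lemma = ℕ-Solver.solve-∀

    ρ≡monomial : ρ ≡ monomial 2 2 3 1 2 3 4
    ρ≡monomial = lemma (y₁ ℕ.^ 2) (y₂ ℕ.^ 2) (y₃ ℕ.^ 3) yℓ (y₄ ℕ.^ 2) (y₅ ℕ.^ 3) (y₆ ℕ.^ 4)
      where
      lemma : ∀ a b c d e f g → a ℕ.* b ℕ.* c ℕ.* d ℕ.* e ℕ.* f ℕ.* g ≡ a ℕ.* b ℕ.* c ℕ.* (d ℕ.* 1) ℕ.* e ℕ.* f ℕ.* g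
      lemma = ℕ-Solver.solve-∀

    monomial[ℓ³4²5] : monomial 0 0 0 3 2 1 0 ≡ yℓ ℕ.^ 3 ℕ.* y₄ ℕ.^ 2 ℕ.* y₅
    monomial[ℓ³4²5] = lemma (yℓ ℕ.^ 3) (y₄ ℕ.^ 2) y₅
      where
      lemma : ∀ a b c → 1 ℕ.* 1 ℕ.* 1 ℕ.* a ℕ.* b ℕ.* (c ℕ.* 1) ℕ.* 1 ≡ a ℕ.* b ℕ.* c
      lemma = ℕ-Solver.solve-∀

    monomial[2] : monomial 0 1 0 0 0 0 0 ≡ y₂
    monomial[2] = lemma y₂
      where
      lemma : ∀ a → 1 ℕ.* (a ℕ.* 1) ℕ.* 1 ℕ.* 1 ℕ.* 1 ℕ.* 1 ℕ.* 1 ≡ a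
      lemma = ℕ-Solver.solve-∀

    monomial[1²3] : monomial 2 0 1 0 0 0 0 ≡ y₁ ℕ.^ 2 ℕ.* y₃
    monomial[1²3] = lemma (y₁ ℕ.^ 2) y₃
      where
      lemma : ∀ a c → a ℕ.* 1 ℕ.* (c ℕ.* 1) ℕ.* 1 ℕ.* 1 ℕ.* 1 ℕ.* 1 ≡ a ℕ.* c
      lemma = ℕ-Solver.solve-∀

    open ≡-Reasoning

    σ*σ : σ ℕ.* σ ≡ cofactor ℕ.* (yℓ ℕ.^ 3 ℕ.* y₄ ℕ.^ 2 ℕ.* y₅)
    σ*σ = begin
      σ ℕ.* σ                             ≡⟨ monomial-* 2 3 4 3 4 5 6 2 3 4 3 4 5 6 ⟩
      monomial 4 6 8 6 8 10 12            ≡⟨ monomial-* 4 6 8 3 6 9 12 0 0 0 3 2 1 0 ⟨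
      cofactor ℕ.* monomial 0 0 0 3 2 1 0 ≡⟨ cong (cofactor ℕ.*_) monomial[ℓ³4²5] ⟩
      cofactor ℕ.* (yℓ ℕ.^ 3 ℕ.* y₄ ℕ.^ 2 ℕ.* y₅) ∎

    σ*κ*κ : σ ℕ.* (κ ℕ.* κ) ≡ cofactor ℕ.* y₂
    σ*κ*κ = begin
      σ ℕ.* (κ ℕ.* κ)                     ≡⟨ cong (λ m → σ ℕ.* (m ℕ.* m)) κ≡monomial ⟩
      σ ℕ.* (monomial 1 2 2 0 1 2 3 ℕ.* monomial 1 2 2 0 1 2 3)
                                          ≡⟨ cong (σ ℕ.*_) (monomial-* 1 2 2 0 1 2 3 1 2 2 0 1 2 3) ⟩
      σ ℕ.* monomial 2 4 4 0 2 4 6        ≡⟨ monomial-* 2 3 4 3 4 5 6 2 4 4 0 2 4 6 ⟩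
      monomial 4 7 8 3 6 9 12             ≡⟨ monomial-* 4 6 8 3 6 9 12 0 1 0 0 0 0 0 ⟨
      cofactor ℕ.* monomial 0 1 0 0 0 0 0 ≡⟨ cong (cofactor ℕ.*_) monomial[2] ⟩
      cofactor ℕ.* y₂                     ∎

    ρ*ρ*ρ : ρ ℕ.* (ρ ℕ.* ρ) ≡ cofactor ℕ.* (y₁ ℕ.^ 2 ℕ.* y₃)
    ρ*ρ*ρ = begin
      ρ ℕ.* (ρ ℕ.* ρ)                     ≡⟨ cong (λ m → m ℕ.* (m ℕ.* m)) ρ≡monomial ⟩
      ρ′ ℕ.* (ρ′ ℕ.* ρ′)                  ≡⟨ cong (ρ′ ℕ.*_) (monomial-* 2 2 3 1 2 3 4 2 2 3 1 2 3 4) ⟩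
      ρ′ ℕ.* monomial 4 4 6 2 4 6 8       ≡⟨ monomial-* 2 2 3 1 2 3 4 4 4 6 2 4 6 8 ⟩
      monomial 6 6 9 3 6 9 12             ≡⟨ monomial-* 4 6 8 3 6 9 12 2 0 1 0 0 0 0 ⟨
      cofactor ℕ.* monomial 2 0 1 0 0 0 0 ≡⟨ cong (cofactor ℕ.*_) monomial[1²3] ⟩
      cofactor ℕ.* (y₁ ℕ.^ 2 ℕ.* y₃)      ∎
      where ρ′ = monomial 2 2 3 1 2 3 4

  curvePoly : Z4 → ℤ
  curvePoly (z4 x0 x1 x2 x3) = x1 * x2 ^ 2 + x2 * x0 ^ 2 + x3 ^ 3

  torsorPoly : Tup → ℤ
  torsorPoly (tup ξ₁ ξ₂ ξ₃ ξℓ ξ₄ ξ₅ ξ₆ τ₁ τ₂ τℓ) =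
    τℓ * (+ ξℓ) ^ 3 * (+ ξ₄) ^ 2 * (+ ξ₅) + (+ τ₂) ^ 2 * (+ ξ₂) + τ₁ ^ 3 * (+ ξ₁) ^ 2 * (+ ξ₃)

  Ψ-cofactor : Tup → ℕ
  Ψ-cofactor (tup ξ₁ ξ₂ ξ₃ ξℓ ξ₄ ξ₅ ξ₆ _ _ _) = Monomial.cofactor ξ₁ ξ₂ ξ₃ ξℓ ξ₄ ξ₅ ξ₆

  pos-^ : ∀ m k → + (m ℕ.^ k) ≡ (+ m) ^ k
  pos-^ m zero    = refl
  pos-^ m (suc k) = trans (pos-* m (m ℕ.^ k)) (cong (+ m *_) (pos-^ m k))

  -- x₂ = σ, x₀ = κ τ₂ and x₃ = ρ τ₁, where c divides σ², σ κ² and ρ³ with the listed quotients.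
  curve-factorisation : ∀ c σ κ ρ τℓ τ₁ τ₂ wℓ w₄ w₅ w₂ w₁ w₃ →
    σ * σ ≡ c * (wℓ * w₄ * w₅) → σ * (κ * κ) ≡ c * w₂ → ρ * (ρ * ρ) ≡ c * (w₁ * w₃) →
    τℓ * σ ^ 2 + σ * (κ * τ₂) ^ 2 + (ρ * τ₁) ^ 3 ≡ c * (τℓ * wℓ * w₄ * w₅ + τ₂ ^ 2 * w₂ + τ₁ ^ 3 * w₁ * w₃)
  curve-factorisation c σ κ ρ τℓ τ₁ τ₂ wℓ w₄ w₅ w₂ w₁ w₃ σ² σκ² ρ³ = begin
    τℓ * σ ^ 2 + σ * (κ * τ₂) ^ 2 + (ρ * τ₁) ^ 3
      ≡⟨ regroup σ κ ρ τℓ τ₁ τ₂ ⟩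
    τℓ * (σ * σ) + (σ * (κ * κ)) * (τ₂ * τ₂) + (ρ * (ρ * ρ)) * (τ₁ * (τ₁ * τ₁))
      ≡⟨ cong₂ _+_ (cong₂ _+_ (cong (τℓ *_) σ²) (cong (_* (τ₂ * τ₂)) σκ²)) (cong (_* (τ₁ * (τ₁ * τ₁))) ρ³) ⟩
    τℓ * (c * (wℓ * w₄ * w₅)) + (c * w₂) * (τ₂ * τ₂) + (c * (w₁ * w₃)) * (τ₁ * (τ₁ * τ₁))
      ≡⟨ factor-out c τℓ τ₁ τ₂ wℓ w₄ w₅ w₂ w₁ w₃ ⟩
    c * (τℓ * wℓ * w₄ * w₅ + τ₂ ^ 2 * w₂ + τ₁ ^ 3 * w₁ * w₃) ∎
    where
    open ≡-Reasoning
    regroup : ∀ σ κ ρ τℓ τ₁ τ₂ →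
      τℓ * (σ * (σ * 1ℤ)) + σ * ((κ * τ₂) * ((κ * τ₂) * 1ℤ)) + (ρ * τ₁) * ((ρ * τ₁) * ((ρ * τ₁) * 1ℤ))
      ≡ τℓ * (σ * σ) + (σ * (κ * κ)) * (τ₂ * τ₂) + (ρ * (ρ * ρ)) * (τ₁ * (τ₁ * τ₁))
    regroup = ℤ-Solver.solve-∀
    factor-out : ∀ c τℓ τ₁ τ₂ wℓ w₄ w₅ w₂ w₁ w₃ →
      τℓ * (c * (wℓ * w₄ * w₅)) + (c * w₂) * (τ₂ * τ₂) + (c * (w₁ * w₃)) * (τ₁ * (τ₁ * τ₁))
      ≡ c * (τℓ * wℓ * w₄ * w₅ + τ₂ * (τ₂ * 1ℤ) * w₂ + τ₁ * (τ₁ * (τ₁ * 1ℤ)) * w₁ * w₃)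
    factor-out = ℤ-Solver.solve-∀

  Ψ-curve : ∀ t → curvePoly (Ψ t) ≡ + Ψ-cofactor t * torsorPoly t
  Ψ-curve (tup ξ₁ ξ₂ ξ₃ ξℓ ξ₄ ξ₅ ξ₆ τ₁ τ₂ τℓ) =
    trans (cong (λ x₀ → τℓ * (+ σ) ^ 2 + (+ σ) * x₀ ^ 2 + (+ ρ * τ₁) ^ 3) (pos-* κ τ₂))
          (curve-factorisation (+ cofactor) (+ σ) (+ κ) (+ ρ) τℓ τ₁ (+ τ₂)
             ((+ ξℓ) ^ 3) ((+ ξ₄) ^ 2) (+ ξ₅) (+ ξ₂) ((+ ξ₁) ^ 2) (+ ξ₃) σ² σκ² ρ³)
    where
    open Monomial ξ₁ ξ₂ ξ₃ ξℓ ξ₄ ξ₅ ξ₆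
    lift : ∀ {m n} → m ≡ n → + m ≡ + n
    lift = cong (+_)
    σ² : + σ * + σ ≡ + cofactor * ((+ ξℓ) ^ 3 * (+ ξ₄) ^ 2 * + ξ₅)
    σ² = begin
      + σ * + σ ≡⟨ pos-* σ σ ⟨
      + (σ ℕ.* σ) ≡⟨ lift σ*σ ⟩
      + (cofactor ℕ.* (ξℓ ℕ.^ 3 ℕ.* ξ₄ ℕ.^ 2 ℕ.* ξ₅))
        ≡⟨ pos-* cofactor _ ⟩
      + cofactor * + (ξℓ ℕ.^ 3 ℕ.* ξ₄ ℕ.^ 2 ℕ.* ξ₅)
        ≡⟨ cong (+ cofactor *_) (trans (pos-* (ξℓ ℕ.^ 3 ℕ.* ξ₄ ℕ.^ 2) ξ₅)
             (cong (_* + ξ₅) (trans (pos-* (ξℓ ℕ.^ 3) (ξ₄ ℕ.^ 2)) (cong₂ _*_ (pos-^ ξℓ 3) (pos-^ ξ₄ 2))))) ⟩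
      + cofactor * ((+ ξℓ) ^ 3 * (+ ξ₄) ^ 2 * + ξ₅) ∎
      where open ≡-Reasoning
    σκ² : + σ * (+ κ * + κ) ≡ + cofactor * + ξ₂
    σκ² = trans (cong (+ σ *_) (sym (pos-* κ κ))) (trans (sym (pos-* σ _)) (trans (lift σ*κ*κ) (pos-* cofactor ξ₂)))
    ρ³ : + ρ * (+ ρ * + ρ) ≡ + cofactor * ((+ ξ₁) ^ 2 * + ξ₃)
    ρ³ = trans (cong (+ ρ *_) (sym (pos-* ρ ρ))) (trans (sym (pos-* ρ _)) (trans (lift ρ*ρ*ρ)
            (trans (pos-* cofactor _) (cong (+ cofactor *_) (trans (pos-* (ξ₁ ℕ.^ 2) ξ₃) (cong (_* + ξ₃) (pos-^ ξ₁ 2)))))))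

module Parametrisation where

  open import Data.Nat.Base as ℕ using (ℕ; zero; suc; z<s)
  import Data.Nat.Properties as ℕ
  import Data.Nat.Divisibility as ℕ
  open import Data.Nat.Primality using (Prime)
  import Data.Nat.GCD as ℕ
  open import Data.Integer.Base
  open import Data.Integer.Properties
  import Data.Integer.Divisibility.Signed as ℤ
  import Data.Integer.Tactic.RingSolver as ℤ-Solver
  open import Data.Integer.GCD using (gcd)
  open import Data.List.Base using (List; []; _∷_)
  open import Data.List.Relation.Unary.All using (All; []; _∷_)
  open import Data.Product.Base using (Σ; _×_; _,_; proj₁; proj₂)
  open import Data.Sum.Base using (inj₁; inj₂)
  open import Data.Empty using (⊥-elim)
  open import Relation.Nullary using (¬_)
  open import Relation.Binary.PropositionalEquality
  open import Function.Base using (_∘_)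

  open Valuation
  open LocalAnalysis
  open CurveIdentity

  ≢0⇒∣∣>0 : ∀ {i} → i ≢ 0ℤ → 0 ℕ.< ∣ i ∣
  ≢0⇒∣∣>0 {+ zero}   i≢0 = ⊥-elim (i≢0 refl)
  ≢0⇒∣∣>0 {+ suc _}  _   = z<s
  ≢0⇒∣∣>0 { -[1+ _ ]} _  = z<s

  ∣∣>0⇒≢0 : ∀ {i} → 0 ℕ.< ∣ i ∣ → i ≢ 0ℤ
  ∣∣>0⇒≢0 0<∣i∣ refl = ℕ.<-irrefl refl 0<∣i∣

  abs-^ : ∀ i k → ∣ i ^ k ∣ ≡ ∣ i ∣ ℕ.^ k
  abs-^ i zero    = refl
  abs-^ i (suc k) = trans (abs-* i (i ^ k)) (cong (∣ i ∣ ℕ.*_) (abs-^ i k))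

  ^-abs-pos : ∀ i k → 0 ℕ.< ∣ i ∣ → 0 ℕ.< ∣ i ^ k ∣
  ^-abs-pos i k 0<∣i∣ = subst (0 ℕ.<_) (sym (abs-^ i k)) (^-pos k 0<∣i∣)

  ν-abs-^ : ∀ {p} → Prime p → ∀ i k → 0 ℕ.< ∣ i ∣ → ν p ∣ i ^ k ∣ ≡ k ℕ.* ν p ∣ i ∣
  ν-abs-^ {p} pr i k 0<∣i∣ = trans (cong (ν p) (abs-^ i k)) (ν-^ pr 0<∣i∣ k)

  *-abs-pos : ∀ i j → 0 ℕ.< ∣ i ∣ → 0 ℕ.< ∣ j ∣ → 0 ℕ.< ∣ i * j ∣
  *-abs-pos i j 0<∣i∣ 0<∣j∣ = subst (0 ℕ.<_) (sym (abs-* i j)) (*-pos 0<∣i∣ 0<∣j∣)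

  ν-abs-* : ∀ {p} → Prime p → ∀ i j → 0 ℕ.< ∣ i ∣ → 0 ℕ.< ∣ j ∣ → ν p ∣ i * j ∣ ≡ ν p ∣ i ∣ ℕ.+ ν p ∣ j ∣
  ν-abs-* {p} pr i j 0<∣i∣ 0<∣j∣ = trans (cong (ν p) (abs-* i j)) (ν-* pr 0<∣i∣ 0<∣j∣)

  valueℤ : Factor → ℤ
  valueℤ (plain m)   = + m
  valueℤ (power m k) = (+ m) ^ k

  mulFactorsℤ : ℤ → List Factor → ℤ
  mulFactorsℤ acc []       = acc
  mulFactorsℤ acc (f ∷ fs) = mulFactorsℤ (acc * valueℤ f) fs

  abs-mulFactorsℤ : ∀ i fs → ∣ mulFactorsℤ i fs ∣ ≡ mulFactors ∣ i ∣ fs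
  abs-mulFactorsℤ i []       = refl
  abs-mulFactorsℤ i (f ∷ fs) = trans (abs-mulFactorsℤ (i * valueℤ f) fs)
    (cong (λ m → mulFactors m fs) (trans (abs-* i (valueℤ f)) (cong (∣ i ∣ ℕ.*_) (abs-value f))))
    where
    abs-value : ∀ f → ∣ valueℤ f ∣ ≡ value f
    abs-value (plain m)   = refl
    abs-value (power m k) = abs-^ (+ m) k

  mulFactorsℤ-pos : ∀ i fs → 0 ℕ.< ∣ i ∣ → All (λ f → 0 ℕ.< base f) fs → 0 ℕ.< ∣ mulFactorsℤ i fs ∣
  mulFactorsℤ-pos i fs 0<∣i∣ 0<fs = subst (0 ℕ.<_) (sym (abs-mulFactorsℤ i fs)) (mulFactors-pos fs 0<∣i∣ 0<fs)

  ν-mulFactorsℤ : ∀ {p} → Prime p → ∀ i fs → 0 ℕ.< ∣ i ∣ → All (λ f → 0 ℕ.< base f) fs →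
                  ν p ∣ mulFactorsℤ i fs ∣ ≡ addValuations p (ν p ∣ i ∣) fs
  ν-mulFactorsℤ {p} pr i fs 0<∣i∣ 0<fs = trans (cong (ν p) (abs-mulFactorsℤ i fs)) (ν-mulFactors pr fs 0<∣i∣ 0<fs)

  ∣-third : ∀ {d} X Y Z → X + Y + Z ≡ 0ℤ → d ℕ.∣ ∣ X ∣ → d ℕ.∣ ∣ Y ∣ → d ℕ.∣ ∣ Z ∣
  ∣-third {d} X Y Z sum≡0 d∣X d∣Y = ℤ.∣⇒∣ᵤ {+ d} {Z}
    (ℤ.∣m+n∣m⇒∣n {m = X + Y} (subst (ℤ._∣_ (+ d)) (sym sum≡0) (ℤ.∣ᵤ⇒∣ {+ d} {0ℤ} (d ℕ.∣0)))
                              (ℤ.∣m∣n⇒∣m+n {m = X} (ℤ.∣ᵤ⇒∣ {+ d} {X} d∣X) (ℤ.∣ᵤ⇒∣ {+ d} {Y} d∣Y)))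

  rotate : ∀ X Y Z → X + Y + Z ≡ 0ℤ → Y + Z + X ≡ 0ℤ
  rotate X Y Z sum≡0 = trans (lemma X Y Z) sum≡0
    where
    lemma : ∀ X Y Z → Y + Z + X ≡ X + Y + Z
    lemma = ℤ-Solver.solve-∀

  -- If one term had strictly smaller valuation than the other two, a higher power of p would divide it.
  sum≡0⇒minAttainedTwice : ∀ {p} → Prime p → ∀ X Y Z → X + Y + Z ≡ 0ℤ →
    0 ℕ.< ∣ X ∣ → 0 ℕ.< ∣ Y ∣ → 0 ℕ.< ∣ Z ∣ → MinAttainedTwice (ν p ∣ X ∣) (ν p ∣ Y ∣) (ν p ∣ Z ∣)
  sum≡0⇒minAttainedTwice {p} pr X Y Z sum≡0 0<X 0<Y 0<Z =
    notUniqueMin X Y Z sum≡0 0<X 0<Y 0<Z ,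
    (λ (Y<X , Y<Z) → notUniqueMin Y Z X (rotate X Y Z sum≡0) 0<Y 0<Z 0<X (Y<Z , Y<X)) ,
    (λ (Z<X , Z<Y) → notUniqueMin Z X Y (rotate Y Z X (rotate X Y Z sum≡0)) 0<Z 0<X 0<Y (Z<X , Z<Y))
    where
    notUniqueMin : ∀ X Y Z → X + Y + Z ≡ 0ℤ → 0 ℕ.< ∣ X ∣ → 0 ℕ.< ∣ Y ∣ → 0 ℕ.< ∣ Z ∣ →
                   ¬ (ν p ∣ X ∣ ℕ.< ν p ∣ Y ∣ × ν p ∣ X ∣ ℕ.< ν p ∣ Z ∣)
    notUniqueMin X Y Z sum≡0 0<X 0<Y 0<Z (X<Y , X<Z) =
      proj₂ (ν-exact pr 0<X) (∣-third Y Z X (rotate X Y Z sum≡0) (≤ν⇒^∣ pr 0<Y X<Y) (≤ν⇒^∣ pr 0<Z X<Z))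

  record NonDegenerate (t : Tup) : Set where
    field
      0<ξ₁ : 0 ℕ.< Tup.ξ₁ t
      0<ξ₂ : 0 ℕ.< Tup.ξ₂ t
      0<ξ₃ : 0 ℕ.< Tup.ξ₃ t
      0<ξℓ : 0 ℕ.< Tup.ξℓ t
      0<ξ₄ : 0 ℕ.< Tup.ξ₄ t
      0<ξ₅ : 0 ℕ.< Tup.ξ₅ t
      0<ξ₆ : 0 ℕ.< Tup.ξ₆ t
      0<∣τ₁∣ : 0 ℕ.< ∣ Tup.τ₁ t ∣
      0<τ₂ : 0 ℕ.< Tup.τ₂ t
      0<∣τℓ∣ : 0 ℕ.< ∣ Tup.τℓ t ∣

  tup-cong : ∀ {ξ₁ ξ₂ ξ₃ ξℓ ξ₄ ξ₅ ξ₆ τ₁ τ₂ τℓ ζ₁ ζ₂ ζ₃ ζℓ ζ₄ ζ₅ ζ₆ σ₁ σ₂ σℓ} →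
    ξ₁ ≡ ζ₁ → ξ₂ ≡ ζ₂ → ξ₃ ≡ ζ₃ → ξℓ ≡ ζℓ → ξ₄ ≡ ζ₄ → ξ₅ ≡ ζ₅ → ξ₆ ≡ ζ₆ → τ₁ ≡ σ₁ → τ₂ ≡ σ₂ → τℓ ≡ σℓ →
    tup ξ₁ ξ₂ ξ₃ ξℓ ξ₄ ξ₅ ξ₆ τ₁ τ₂ τℓ ≡ tup ζ₁ ζ₂ ζ₃ ζℓ ζ₄ ζ₅ ζ₆ σ₁ σ₂ σℓ
  tup-cong refl refl refl refl refl refl refl refl refl refl = refl

  z4-cong : ∀ {a b c d a′ c′ d′} → a ≡ a′ → c ≡ c′ → d ≡ d′ → z4 a b c d ≡ z4 a′ b c′ d′
  z4-cong refl refl refl = refl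

  exps-cong : ∀ {a₁ a₂ a₃ aℓ a₄ a₅ a₆ b₁ b₂ bℓ} {a} →
    a₁ ≡ α₁ a → a₂ ≡ α₂ a → a₃ ≡ α₃ a → aℓ ≡ αℓ a → a₄ ≡ α₄ a → a₅ ≡ α₅ a → a₆ ≡ α₆ a →
    b₁ ≡ β₁ a → b₂ ≡ β₂ a → bℓ ≡ βℓ a → exps a₁ a₂ a₃ aℓ a₄ a₅ a₆ b₁ b₂ bℓ ≡ a
  exps-cong refl refl refl refl refl refl refl refl refl refl = refl

  T₁⇒nonDegenerate : ∀ t → T₁ t → NonDegenerate t
  T₁⇒nonDegenerate _ ((0<ξ₁ , 0<ξ₂ , 0<ξ₃ , 0<ξℓ , 0<ξ₄ , 0<ξ₅ , 0<ξ₆) , τ₁≢0 , 0<τ₂ , τℓ≢0 , _) =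
    record { 0<ξ₁ = 0<ξ₁ ; 0<ξ₂ = 0<ξ₂ ; 0<ξ₃ = 0<ξ₃ ; 0<ξℓ = 0<ξℓ ; 0<ξ₄ = 0<ξ₄ ; 0<ξ₅ = 0<ξ₅ ; 0<ξ₆ = 0<ξ₆
           ; 0<∣τ₁∣ = ≢0⇒∣∣>0 τ₁≢0 ; 0<τ₂ = 0<τ₂ ; 0<∣τℓ∣ = ≢0⇒∣∣>0 τℓ≢0 }

  localExponents : ℕ → Tup → Exponents
  localExponents p (tup ξ₁ ξ₂ ξ₃ ξℓ ξ₄ ξ₅ ξ₆ τ₁ τ₂ τℓ) =
    exps (ν p ξ₁) (ν p ξ₂) (ν p ξ₃) (ν p ξℓ) (ν p ξ₄) (ν p ξ₅) (ν p ξ₆) (ν p ∣ τ₁ ∣) (ν p τ₂) (ν p ∣ τℓ ∣)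

  ν₀ ν₁ ν₂ ν₃ : ℕ → Z4 → ℕ
  ν₀ p x = ν p ∣ Z4.x0 x ∣
  ν₁ p x = ν p ∣ Z4.x1 x ∣
  ν₂ p x = ν p ∣ Z4.x2 x ∣
  ν₃ p x = ν p ∣ Z4.x3 x ∣

  decodeAt : ℕ → Z4 → Exponents
  decodeAt p x = decode (ν₀ p x) (ν₁ p x) (ν₂ p x) (ν₃ p x)

  AllNonzero : Z4 → Set
  AllNonzero x = 0 ℕ.< ∣ Z4.x0 x ∣ × 0 ℕ.< ∣ Z4.x1 x ∣ × 0 ℕ.< ∣ Z4.x2 x ∣ × 0 ℕ.< ∣ Z4.x3 x ∣

  allNonzero⇒product≢0 : ∀ x → AllNonzero x → Z4.x0 x * Z4.x1 x * Z4.x2 x * Z4.x3 x ≢ 0ℤ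
  allNonzero⇒product≢0 (z4 x0 x1 x2 x3) (0<x0 , 0<x1 , 0<x2 , 0<x3) =
    ∣∣>0⇒≢0 (*-abs-pos (x0 * x1 * x2) x3 (*-abs-pos (x0 * x1) x2 (*-abs-pos x0 x1 0<x0 0<x1) 0<x2) 0<x3)

  product≢0⇒allNonzero : ∀ x → Z4.x0 x * Z4.x1 x * Z4.x2 x * Z4.x3 x ≢ 0ℤ → AllNonzero x
  product≢0⇒allNonzero (z4 x0 x1 x2 x3) x0x1x2x3≢0 =
    ≢0⇒∣∣>0 (≢0ˡ x0 x1 (≢0ˡ (x0 * x1) x2 x0x1x2≢0)) , ≢0⇒∣∣>0 (≢0ʳ x0 x1 (≢0ˡ (x0 * x1) x2 x0x1x2≢0)) ,
    ≢0⇒∣∣>0 (≢0ʳ (x0 * x1) x2 x0x1x2≢0) , ≢0⇒∣∣>0 (≢0ʳ (x0 * x1 * x2) x3 x0x1x2x3≢0)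
    where
    ≢0ˡ : ∀ i j → i * j ≢ 0ℤ → i ≢ 0ℤ
    ≢0ˡ i j ij≢0 refl = ij≢0 refl
    ≢0ʳ : ∀ i j → i * j ≢ 0ℤ → j ≢ 0ℤ
    ≢0ʳ i j ij≢0 refl = ij≢0 (*-zeroʳ i)
    x0x1x2≢0 = ≢0ˡ (x0 * x1 * x2) x3 x0x1x2x3≢0

  Primitive : Z4 → Set
  Primitive (z4 x0 x1 x2 x3) = gcd (gcd x0 x1) (gcd x2 x3) ≡ 1ℤ

  primitive⇒notAllPositive : ∀ x → AllNonzero x → Primitive x →
    ∀ {p} → Prime p → NotAllPositive (ν₀ p x) (ν₁ p x) (ν₂ p x) (ν₃ p x)
  primitive⇒notAllPositive (z4 x0 x1 x2 x3) (0<x0 , 0<x1 , 0<x2 , 0<x3) gcd≡1 {p} pr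
    with notAllPositive? (ν₀ p (z4 x0 x1 x2 x3)) (ν₁ p (z4 x0 x1 x2 x3)) (ν₂ p (z4 x0 x1 x2 x3)) (ν₃ p (z4 x0 x1 x2 x3))
  ... | inj₁ notAll = notAll
  ... | inj₂ (ν₀>0 , ν₁>0 , ν₂>0 , ν₃>0) = ⊥-elim (gcd≡1⇒¬common-prime (+-injective gcd≡1) pr
          (ℕ.gcd-greatest (ν>0⇒∣ pr 0<x0 ν₀>0) (ν>0⇒∣ pr 0<x1 ν₁>0))
          (ℕ.gcd-greatest (ν>0⇒∣ pr 0<x2 ν₂>0) (ν>0⇒∣ pr 0<x3 ν₃>0)))

  notAllPositive⇒primitive : ∀ x → AllNonzero x →
    (∀ {p} → Prime p → NotAllPositive (ν₀ p x) (ν₁ p x) (ν₂ p x) (ν₃ p x)) → Primitive x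
  notAllPositive⇒primitive (z4 x0 x1 x2 x3) (0<x0 , 0<x1 , 0<x2 , 0<x3) notAll =
    cong (+_) (¬common-prime⇒gcd≡1 (gcd-pos _ 0<x0) λ p pr p∣g₀₁ p∣g₂₃ →
      notAllPositive⇒¬allPositive (notAll pr)
        ( ∣⇒ν>0 pr 0<x0 (ℕ.∣-trans p∣g₀₁ (ℕ.gcd[m,n]∣m ∣ x0 ∣ ∣ x1 ∣))
        , ∣⇒ν>0 pr 0<x1 (ℕ.∣-trans p∣g₀₁ (ℕ.gcd[m,n]∣n ∣ x0 ∣ ∣ x1 ∣))
        , ∣⇒ν>0 pr 0<x2 (ℕ.∣-trans p∣g₂₃ (ℕ.gcd[m,n]∣m ∣ x2 ∣ ∣ x3 ∣))
        , ∣⇒ν>0 pr 0<x3 (ℕ.∣-trans p∣g₂₃ (ℕ.gcd[m,n]∣n ∣ x2 ∣ ∣ x3 ∣))))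

  curve≡0⇒curveMin : ∀ x → AllNonzero x → curvePoly x ≡ 0ℤ →
    ∀ {p} → Prime p → CurveMin (ν₀ p x) (ν₁ p x) (ν₂ p x) (ν₃ p x)
  curve≡0⇒curveMin (z4 x0 x1 x2 x3) (0<x0 , 0<x1 , 0<x2 , 0<x3) curve≡0 pr = min-cong
    (trans (ν-abs-* pr x1 (x2 ^ 2) 0<x1 (^-abs-pos x2 2 0<x2)) (cong (ν _ ∣ x1 ∣ ℕ.+_) (ν-abs-^ pr x2 2 0<x2)))
    (trans (ν-abs-* pr x2 (x0 ^ 2) 0<x2 (^-abs-pos x0 2 0<x0)) (cong (ν _ ∣ x2 ∣ ℕ.+_) (ν-abs-^ pr x0 2 0<x0)))
    (ν-abs-^ pr x3 3 0<x3)
    (sum≡0⇒minAttainedTwice pr (x1 * x2 ^ 2) (x2 * x0 ^ 2) (x3 ^ 3) curve≡0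
      (*-abs-pos x1 (x2 ^ 2) 0<x1 (^-abs-pos x2 2 0<x2))
      (*-abs-pos x2 (x0 ^ 2) 0<x2 (^-abs-pos x0 2 0<x0))
      (^-abs-pos x3 3 0<x3))

  module ValuationsOfΨ {t : Tup} (nd : NonDegenerate t) where

    open Tup t
    open NonDegenerate nd

    x₀-factors x₂-factors ρ-factors : List Factor
    x₀-factors = power ξ₂ 2 ∷ power ξ₃ 2 ∷ plain ξ₄ ∷ power ξ₅ 2 ∷ power ξ₆ 3 ∷ plain τ₂ ∷ []
    x₂-factors = power ξ₂ 3 ∷ power ξ₃ 4 ∷ power ξℓ 3 ∷ power ξ₄ 4 ∷ power ξ₅ 5 ∷ power ξ₆ 6 ∷ []
    ρ-factors  = power ξ₂ 2 ∷ power ξ₃ 3 ∷ plain ξℓ ∷ power ξ₄ 2 ∷ power ξ₅ 3 ∷ power ξ₆ 4 ∷ []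

    x₀-factors-pos : All (λ f → 0 ℕ.< base f) x₀-factors
    x₀-factors-pos = 0<ξ₂ ∷ 0<ξ₃ ∷ 0<ξ₄ ∷ 0<ξ₅ ∷ 0<ξ₆ ∷ 0<τ₂ ∷ []
    x₂-factors-pos : All (λ f → 0 ℕ.< base f) x₂-factors
    x₂-factors-pos = 0<ξ₂ ∷ 0<ξ₃ ∷ 0<ξℓ ∷ 0<ξ₄ ∷ 0<ξ₅ ∷ 0<ξ₆ ∷ []
    ρ-factors-pos : All (λ f → 0 ℕ.< base f) ρ-factors
    ρ-factors-pos = 0<ξ₂ ∷ 0<ξ₃ ∷ 0<ξℓ ∷ 0<ξ₄ ∷ 0<ξ₅ ∷ 0<ξ₆ ∷ []

    ρ : ℕ
    ρ = mulFactors (ξ₁ ℕ.^ 2) ρ-factors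

    0<ρ : 0 ℕ.< ρ
    0<ρ = mulFactors-pos ρ-factors (^-pos 2 0<ξ₁) ρ-factors-pos

    ∣x₃∣≡ : ∣ Z4.x3 (Ψ t) ∣ ≡ ρ ℕ.* ∣ τ₁ ∣
    ∣x₃∣≡ = abs-* (+ ρ) τ₁

    Ψ-allNonzero : AllNonzero (Ψ t)
    Ψ-allNonzero = mulFactors-pos x₀-factors 0<ξ₁ x₀-factors-pos , 0<∣τℓ∣ ,
                   mulFactors-pos x₂-factors (^-pos 2 0<ξ₁) x₂-factors-pos ,
                   subst (0 ℕ.<_) (sym ∣x₃∣≡) (*-pos 0<ρ 0<∣τ₁∣)

    sign-x₃ : sign (Z4.x3 (Ψ t)) ≡ sign τ₁
    sign-x₃ = sign-* (+ ρ) τ₁ {{ℕ.>-nonZero (proj₂ (proj₂ (proj₂ Ψ-allNonzero)))}}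

    sf-factors g₁-factors g₂-factors gℓ-factors : List Factor
    sf-factors = plain ξ₂ ∷ plain ξ₃ ∷ plain ξ₄ ∷ plain ξ₅ ∷ []
    g₁-factors = plain ξℓ ∷ plain ξ₄ ∷ plain ξ₅ ∷ []
    g₂-factors = plain ξ₃ ∷ []
    gℓ-factors = plain ξ₅ ∷ plain ξ₆ ∷ []

    sf-pos : All (λ f → 0 ℕ.< base f) sf-factors
    sf-pos = 0<ξ₂ ∷ 0<ξ₃ ∷ 0<ξ₄ ∷ 0<ξ₅ ∷ []
    g₁-pos : All (λ f → 0 ℕ.< base f) g₁-factors
    g₁-pos = 0<ξℓ ∷ 0<ξ₄ ∷ 0<ξ₅ ∷ []
    g₂-pos : All (λ f → 0 ℕ.< base f) g₂-factors
    g₂-pos = 0<ξ₃ ∷ []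
    gℓ-pos : All (λ f → 0 ℕ.< base f) gℓ-factors
    gℓ-pos = 0<ξ₅ ∷ 0<ξ₆ ∷ []

    module _ {p : ℕ} (pr : Prime p) where

      ν-ξ₁² : ν p (ξ₁ ℕ.^ 2) ≡ 2 ℕ.* ν p ξ₁
      ν-ξ₁² = ν-^ pr 0<ξ₁ 2

      ν₀-Ψ : ν₀ p (Ψ t) ≡ ψ₀ (localExponents p t)
      ν₀-Ψ = ν-mulFactors pr x₀-factors 0<ξ₁ x₀-factors-pos

      ν₂-Ψ : ν₂ p (Ψ t) ≡ ψ₂ (localExponents p t)
      ν₂-Ψ = trans (ν-mulFactors pr x₂-factors (^-pos 2 0<ξ₁) x₂-factors-pos)
                   (cong (λ v → addValuations p v x₂-factors) ν-ξ₁²)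

      ν₃-Ψ : ν₃ p (Ψ t) ≡ ψ₃ (localExponents p t)
      ν₃-Ψ = begin
        ν p ∣ Z4.x3 (Ψ t) ∣      ≡⟨ cong (ν p) ∣x₃∣≡ ⟩
        ν p (ρ ℕ.* ∣ τ₁ ∣)       ≡⟨ ν-* pr 0<ρ 0<∣τ₁∣ ⟩
        ν p ρ ℕ.+ ν p ∣ τ₁ ∣     ≡⟨ cong (ℕ._+ ν p ∣ τ₁ ∣) (ν-mulFactors pr ρ-factors (^-pos 2 0<ξ₁) ρ-factors-pos) ⟩
        addValuations p (ν p (ξ₁ ℕ.^ 2)) ρ-factors ℕ.+ ν p ∣ τ₁ ∣
                                 ≡⟨ cong (λ v → addValuations p v ρ-factors ℕ.+ ν p ∣ τ₁ ∣) ν-ξ₁² ⟩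
        ψ₃ (localExponents p t)  ∎
        where open ≡-Reasoning

      torsorℓ-factors torsor₂-factors torsor₁-factors : List Factor
      torsorℓ-factors = power ξℓ 3 ∷ power ξ₄ 2 ∷ plain ξ₅ ∷ []
      torsor₂-factors = plain ξ₂ ∷ []
      torsor₁-factors = power ξ₁ 2 ∷ plain ξ₃ ∷ []

      torsorℓ-pos : All (λ f → 0 ℕ.< base f) torsorℓ-factors
      torsorℓ-pos = 0<ξℓ ∷ 0<ξ₄ ∷ 0<ξ₅ ∷ []
      torsor₂-pos : All (λ f → 0 ℕ.< base f) torsor₂-factors
      torsor₂-pos = 0<ξ₂ ∷ []
      torsor₁-pos : All (λ f → 0 ℕ.< base f) torsor₁-factors
      torsor₁-pos = 0<ξ₁ ∷ 0<ξ₃ ∷ []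

      torsorMin : torsorPoly t ≡ 0ℤ → TorsorMin (localExponents p t)
      torsorMin sum≡0 = min-cong
        (ν-mulFactorsℤ pr τℓ torsorℓ-factors 0<∣τℓ∣ torsorℓ-pos)
        (trans (ν-mulFactorsℤ pr ((+ τ₂) ^ 2) torsor₂-factors (^-abs-pos (+ τ₂) 2 0<τ₂) torsor₂-pos)
               (cong (λ v → addValuations p v torsor₂-factors) (ν-abs-^ pr (+ τ₂) 2 0<τ₂)))
        (trans (ν-mulFactorsℤ pr (τ₁ ^ 3) torsor₁-factors (^-abs-pos τ₁ 3 0<∣τ₁∣) torsor₁-pos)
               (cong (λ v → addValuations p v torsor₁-factors) (ν-abs-^ pr τ₁ 3 0<∣τ₁∣)))
        (sum≡0⇒minAttainedTwice pr (mulFactorsℤ τℓ torsorℓ-factors) (mulFactorsℤ ((+ τ₂) ^ 2) torsor₂-factors)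
                                   (mulFactorsℤ (τ₁ ^ 3) torsor₁-factors) sum≡0
          (mulFactorsℤ-pos τℓ torsorℓ-factors 0<∣τℓ∣ torsorℓ-pos)
          (mulFactorsℤ-pos ((+ τ₂) ^ 2) torsor₂-factors (^-abs-pos (+ τ₂) 2 0<τ₂) torsor₂-pos)
          (mulFactorsℤ-pos (τ₁ ^ 3) torsor₁-factors (^-abs-pos τ₁ 3 0<∣τ₁∣) torsor₁-pos))

      coprime⇒disjoint : ∀ {m} n fs → 0 ℕ.< m → 0 ℕ.< n → All (λ f → 0 ℕ.< base f) fs →
                         ℕ.gcd m (mulFactors n fs) ≡ 1 → Disjoint (ν p m) (addValuations p (ν p n) fs)
      coprime⇒disjoint {m} n fs 0<m 0<n 0<fs gcd≡1 =
        subst (Disjoint (ν p m)) (ν-mulFactors pr fs 0<n 0<fs) (gcd≡1⇒ν-disjoint gcd≡1 pr 0<m (mulFactors-pos fs 0<n 0<fs))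

      localAdmissible : SquareFree (ξ₁ ℕ.* ξ₂ ℕ.* ξ₃ ℕ.* ξ₄ ℕ.* ξ₅) →
                        gcd τ₁ (+ (ξ₂ ℕ.* ξℓ ℕ.* ξ₄ ℕ.* ξ₅)) ≡ 1ℤ → gcd (+ τ₂) (+ (ξ₁ ℕ.* ξ₃)) ≡ 1ℤ →
                        gcd τℓ (+ (ξ₄ ℕ.* ξ₅ ℕ.* ξ₆)) ≡ 1ℤ → Admissible (localExponents p t)
      localAdmissible sf gcd₁ gcd₂ gcdℓ = record
        { squareFree = subst (ℕ._≤ 1) (ν-mulFactors pr sf-factors 0<ξ₁ sf-pos)
                                      (squareFree⇒ν≤1 sf pr (mulFactors-pos sf-factors 0<ξ₁ sf-pos))
        ; coprime₁ = coprime⇒disjoint ξ₂ g₁-factors 0<∣τ₁∣ 0<ξ₂ g₁-pos (+-injective gcd₁)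
        ; coprime₂ = coprime⇒disjoint ξ₁ g₂-factors 0<τ₂ 0<ξ₁ g₂-pos (+-injective gcd₂)
        ; coprimeℓ = coprime⇒disjoint ξ₄ gℓ-factors 0<∣τℓ∣ 0<ξ₄ gℓ-pos (+-injective gcdℓ)
        }

    0<Ψ-cofactor : 0 ℕ.< Ψ-cofactor t
    0<Ψ-cofactor = mulFactors-pos (power ξ₂ 6 ∷ power ξ₃ 8 ∷ power ξℓ 3 ∷ power ξ₄ 6 ∷ power ξ₅ 9 ∷ power ξ₆ 12 ∷ [])
                     (^-pos 4 0<ξ₁) (0<ξ₂ ∷ 0<ξ₃ ∷ 0<ξℓ ∷ 0<ξ₄ ∷ 0<ξ₅ ∷ 0<ξ₆ ∷ [])

    disjoint⇒coprime : ∀ {m} n fs → 0 ℕ.< m → 0 ℕ.< n → All (λ f → 0 ℕ.< base f) fs →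
                       (∀ {p} → Prime p → Disjoint (ν p m) (addValuations p (ν p n) fs)) → ℕ.gcd m (mulFactors n fs) ≡ 1
    disjoint⇒coprime {m} n fs 0<m 0<n 0<fs disjoint = ν-disjoint⇒gcd≡1 0<m (mulFactors-pos fs 0<n 0<fs)
      λ _ pr → subst (Disjoint (ν _ m)) (sym (ν-mulFactors pr fs 0<n 0<fs)) (disjoint pr)

    admissible⇒conditions : (∀ {p} → Prime p → Admissible (localExponents p t)) →
                            SquareFree (ξ₁ ℕ.* ξ₂ ℕ.* ξ₃ ℕ.* ξ₄ ℕ.* ξ₅) ×
                            gcd τ₁ (+ (ξ₂ ℕ.* ξℓ ℕ.* ξ₄ ℕ.* ξ₅)) ≡ 1ℤ × gcd (+ τ₂) (+ (ξ₁ ℕ.* ξ₃)) ≡ 1ℤ ×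
                            gcd τℓ (+ (ξ₄ ℕ.* ξ₅ ℕ.* ξ₆)) ≡ 1ℤ
    admissible⇒conditions adm =
      ν≤1⇒squareFree (mulFactors-pos sf-factors 0<ξ₁ sf-pos)
        (λ _ pr → subst (ℕ._≤ 1) (sym (ν-mulFactors pr sf-factors 0<ξ₁ sf-pos)) (Admissible.squareFree (adm pr))) ,
      cong (+_) (disjoint⇒coprime ξ₂ g₁-factors 0<∣τ₁∣ 0<ξ₂ g₁-pos (Admissible.coprime₁ ∘ adm)) ,
      cong (+_) (disjoint⇒coprime ξ₁ g₂-factors 0<τ₂ 0<ξ₁ g₂-pos (Admissible.coprime₂ ∘ adm)) ,
      cong (+_) (disjoint⇒coprime ξ₄ gℓ-factors 0<∣τℓ∣ 0<ξ₄ gℓ-pos (Admissible.coprimeℓ ∘ adm))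

  T₁⇒realises : ∀ t → T₁ t → ∀ {p} → Prime p →
                Realises (localExponents p t) (ν₀ p (Ψ t)) (ν₁ p (Ψ t)) (ν₂ p (Ψ t)) (ν₃ p (Ψ t))
  T₁⇒realises t t∈T₁@(_ , _ , _ , _ , _ , sf , gcd₁ , gcd₂ , gcdℓ) pr = record
    { ψ₀≡ = sym (ν₀-Ψ pr) ; ψ₁≡ = refl ; ψ₂≡ = sym (ν₂-Ψ pr) ; ψ₃≡ = sym (ν₃-Ψ pr)
    ; admissible = localAdmissible pr sf gcd₁ gcd₂ gcdℓ }
    where open ValuationsOfΨ (T₁⇒nonDegenerate t t∈T₁)

  T₁⇒torsorMin : ∀ t → T₁ t → ∀ {p} → Prime p → TorsorMin (localExponents p t)
  T₁⇒torsorMin t t∈T₁@(_ , _ , _ , _ , torsor≡0 , _) pr = ValuationsOfΨ.torsorMin (T₁⇒nonDegenerate t t∈T₁) pr torsor≡0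

  T₁⇒localExponents≡decodeAt : ∀ t → T₁ t → ∀ {p} → Prime p → localExponents p t ≡ decodeAt p (Ψ t)
  T₁⇒localExponents≡decodeAt t t∈T₁ pr =
    trans (sym (decode-ψ _ (admissible r) (T₁⇒torsorMin t t∈T₁ pr))) (decode-cong-ψ r)
    where r = T₁⇒realises t t∈T₁ pr

  Ψ-into-E : ∀ t → T₁ t → E (Ψ t)
  Ψ-into-E t t∈T₁@(_ , _ , _ , _ , torsor≡0 , _) =
    notAllPositive⇒primitive (Ψ t) Ψ-allNonzero notAllPositive ,
    allNonzero⇒product≢0 (Ψ t) Ψ-allNonzero ,
    +<+ (proj₁ Ψ-allNonzero) , +<+ (proj₁ (proj₂ (proj₂ Ψ-allNonzero))) ,
    trans (Ψ-curve t) (trans (cong (+ Ψ-cofactor t *_) torsor≡0) (*-zeroʳ (+ Ψ-cofactor t)))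
    where
    open ValuationsOfΨ (T₁⇒nonDegenerate t t∈T₁)
    notAllPositive : ∀ {p} → Prime p → NotAllPositive (ν₀ p (Ψ t)) (ν₁ p (Ψ t)) (ν₂ p (Ψ t)) (ν₃ p (Ψ t))
    notAllPositive pr = realises-subst NotAllPositive r (ψ-notAllPositive _ (admissible r) (T₁⇒torsorMin t t∈T₁ pr))
      where r = T₁⇒realises t t∈T₁ pr

  Ψ-injective : ∀ t u → T₁ t → T₁ u → Ψ t ≡ Ψ u → t ≡ u
  Ψ-injective t u t∈T₁ u∈T₁ Ψt≡Ψu = tup-cong
    (≡-by-ν (0<ξ₁ ndt) (0<ξ₁ ndu) λ _ pr → cong α₁ (sameExponents pr))
    (≡-by-ν (0<ξ₂ ndt) (0<ξ₂ ndu) λ _ pr → cong α₂ (sameExponents pr))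
    (≡-by-ν (0<ξ₃ ndt) (0<ξ₃ ndu) λ _ pr → cong α₃ (sameExponents pr))
    (≡-by-ν (0<ξℓ ndt) (0<ξℓ ndu) λ _ pr → cong αℓ (sameExponents pr))
    (≡-by-ν (0<ξ₄ ndt) (0<ξ₄ ndu) λ _ pr → cong α₄ (sameExponents pr))
    (≡-by-ν (0<ξ₅ ndt) (0<ξ₅ ndu) λ _ pr → cong α₅ (sameExponents pr))
    (≡-by-ν (0<ξ₆ ndt) (0<ξ₆ ndu) λ _ pr → cong α₆ (sameExponents pr))
    (◃-cong (trans (sym (ValuationsOfΨ.sign-x₃ ndt)) (trans (cong (sign ∘ Z4.x3) Ψt≡Ψu) (ValuationsOfΨ.sign-x₃ ndu)))
            (≡-by-ν (0<∣τ₁∣ ndt) (0<∣τ₁∣ ndu) λ _ pr → cong β₁ (sameExponents pr)))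
    (≡-by-ν (0<τ₂ ndt) (0<τ₂ ndu) λ _ pr → cong β₂ (sameExponents pr))
    (cong Z4.x1 Ψt≡Ψu)
    where
    open NonDegenerate
    ndt = T₁⇒nonDegenerate t t∈T₁
    ndu = T₁⇒nonDegenerate u u∈T₁
    sameExponents : ∀ {p} → Prime p → localExponents p t ≡ localExponents p u
    sameExponents pr = trans (T₁⇒localExponents≡decodeAt t t∈T₁ pr)
                             (trans (cong (decodeAt _) Ψt≡Ψu) (sym (T₁⇒localExponents≡decodeAt u u∈T₁ pr)))

  module Preimage (n₀ : ℕ) (x₁ : ℤ) (n₂ : ℕ) (x₃ : ℤ) where

    x : Z4
    x = z4 (+ n₀) x₁ (+ n₂) x₃

    module _ (nz : AllNonzero x) (prim : Primitive x) (curve≡0 : curvePoly x ≡ 0ℤ) where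

      -- Primes beyond N divide none of x₀, x₂, x₃, so only finitely many primes enter the ξ's.
      N : ℕ
      N = n₀ ℕ.* n₂ ℕ.* ∣ x₃ ∣

      realisesAt : ∀ {p} → Prime p → Realises (decodeAt p x) (ν₀ p x) (ν₁ p x) (ν₂ p x) (ν₃ p x)
      realisesAt pr = decode-realises _ _ _ _ (primitive⇒notAllPositive x nz prim pr) (curve≡0⇒curveMin x nz curve≡0 pr)

      0<n₀ : 0 ℕ.< n₀
      0<n₀ = proj₁ nz
      0<∣x₁∣ : 0 ℕ.< ∣ x₁ ∣
      0<∣x₁∣ = proj₁ (proj₂ nz)
      0<n₂ : 0 ℕ.< n₂
      0<n₂ = proj₁ (proj₂ (proj₂ nz))
      0<∣x₃∣ : 0 ℕ.< ∣ x₃ ∣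
      0<∣x₃∣ = proj₂ (proj₂ (proj₂ nz))

      n₀≤N : n₀ ℕ.≤ N
      n₀≤N = ℕ.≤-trans (ℕ.m≤m*n n₀ n₂ {{ℕ.>-nonZero 0<n₂}}) (ℕ.m≤m*n (n₀ ℕ.* n₂) ∣ x₃ ∣ {{ℕ.>-nonZero 0<∣x₃∣}})
      n₂≤N : n₂ ℕ.≤ N
      n₂≤N = ℕ.≤-trans (ℕ.m≤n*m n₂ n₀ {{ℕ.>-nonZero 0<n₀}}) (ℕ.m≤m*n (n₀ ℕ.* n₂) ∣ x₃ ∣ {{ℕ.>-nonZero 0<∣x₃∣}})
      x₃≤N : ∣ x₃ ∣ ℕ.≤ N
      x₃≤N = ℕ.m≤n*m ∣ x₃ ∣ (n₀ ℕ.* n₂) {{ℕ.>-nonZero (*-pos 0<n₀ 0<n₂)}}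

      decodeAt-large : ∀ {p} → Prime p → N ℕ.< p → decodeAt p x ≡ exps 0 0 0 0 0 0 0 0 0 (ν₁ p x)
      decodeAt-large {p} pr N<p
        rewrite n<p⇒ν≡0 pr 0<n₀ (ℕ.≤-<-trans n₀≤N N<p)
              | n<p⇒ν≡0 pr 0<n₂ (ℕ.≤-<-trans n₂≤N N<p)
              | n<p⇒ν≡0 pr 0<∣x₃∣ (ℕ.≤-<-trans x₃≤N N<p) = refl

      ξ : (Exponents → ℕ) → ℕ
      ξ f = primeProduct N (λ p → f (decodeAt p x))

      ν-ξ : ∀ (f : Exponents → ℕ) → (∀ e → f (exps 0 0 0 0 0 0 0 0 0 e) ≡ 0) → ∀ {p} → Prime p → ν p (ξ f) ≡ f (decodeAt p x)
      ν-ξ f f-vanishes {p} = ν-primeProduct N _ (λ q qr N<q → trans (cong f (decodeAt-large qr N<q)) (f-vanishes _)) p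

      t : Tup
      t = tup (ξ α₁) (ξ α₂) (ξ α₃) (ξ αℓ) (ξ α₄) (ξ α₅) (ξ α₆) (sign x₃ ◃ ξ β₁) (ξ β₂) x₁

      ∣τ₁∣≡ : ∣ sign x₃ ◃ ξ β₁ ∣ ≡ ξ β₁
      ∣τ₁∣≡ = abs-◃ (sign x₃) (ξ β₁)

      t-nonDegenerate : NonDegenerate t
      t-nonDegenerate = record
        { 0<ξ₁ = primeProduct-pos N _ ; 0<ξ₂ = primeProduct-pos N _ ; 0<ξ₃ = primeProduct-pos N _
        ; 0<ξℓ = primeProduct-pos N _ ; 0<ξ₄ = primeProduct-pos N _ ; 0<ξ₅ = primeProduct-pos N _
        ; 0<ξ₆ = primeProduct-pos N _ ; 0<∣τ₁∣ = subst (0 ℕ.<_) (sym ∣τ₁∣≡) (primeProduct-pos N _)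
        ; 0<τ₂ = primeProduct-pos N _ ; 0<∣τℓ∣ = 0<∣x₁∣ }

      localExponents≡decodeAt : ∀ {p} → Prime p → localExponents p t ≡ decodeAt p x
      localExponents≡decodeAt {p} pr = exps-cong
        (ν-ξ α₁ (λ _ → refl) pr) (ν-ξ α₂ (λ _ → refl) pr) (ν-ξ α₃ (λ _ → refl) pr) (ν-ξ αℓ (λ _ → refl) pr)
        (ν-ξ α₄ (λ _ → refl) pr) (ν-ξ α₅ (λ _ → refl) pr) (ν-ξ α₆ (λ _ → refl) pr)
        (trans (cong (ν p) ∣τ₁∣≡) (ν-ξ β₁ (λ _ → refl) pr)) (ν-ξ β₂ (λ _ → refl) pr)
        (sym (ψ₁≡ (realisesAt pr)))

      t-realises : ∀ {p} → Prime p → Realises (localExponents p t) (ν₀ p x) (ν₁ p x) (ν₂ p x) (ν₃ p x)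
      t-realises pr = subst (λ a → Realises a _ _ _ _) (sym (localExponents≡decodeAt pr)) (realisesAt pr)

      open ValuationsOfΨ t-nonDegenerate

      Ψt≡x : Ψ t ≡ x
      Ψt≡x = z4-cong
        (cong (+_) (≡-by-ν (proj₁ Ψ-allNonzero) 0<n₀ λ _ pr → trans (ν₀-Ψ pr) (ψ₀≡ (t-realises pr))))
        (cong (+_) (≡-by-ν (proj₁ (proj₂ (proj₂ Ψ-allNonzero))) 0<n₂ λ _ pr → trans (ν₂-Ψ pr) (ψ₂≡ (t-realises pr))))
        (◃-cong (trans sign-x₃ (sign-◃ (sign x₃) (ξ β₁) {{ℕ.>-nonZero (primeProduct-pos N _)}}))
                (≡-by-ν (proj₂ (proj₂ (proj₂ Ψ-allNonzero))) 0<∣x₃∣ λ _ pr → trans (ν₃-Ψ pr) (ψ₃≡ (t-realises pr))))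

      torsor≡0 : torsorPoly t ≡ 0ℤ
      torsor≡0 = *-cancelˡ-≡ (+ Ψ-cofactor t) (torsorPoly t) 0ℤ {{ℕ.>-nonZero 0<Ψ-cofactor}} (begin
        + Ψ-cofactor t * torsorPoly t ≡⟨ Ψ-curve t ⟨
        curvePoly (Ψ t)               ≡⟨ cong curvePoly Ψt≡x ⟩
        curvePoly x                   ≡⟨ curve≡0 ⟩
        0ℤ                            ≡⟨ *-zeroʳ (+ Ψ-cofactor t) ⟨
        + Ψ-cofactor t * 0ℤ           ∎)
        where open ≡-Reasoning

      t∈T₁ : T₁ t
      t∈T₁ = (0<ξ₁ , 0<ξ₂ , 0<ξ₃ , 0<ξℓ , 0<ξ₄ , 0<ξ₅ , 0<ξ₆) , ∣∣>0⇒≢0 0<∣τ₁∣ , 0<τ₂ , ∣∣>0⇒≢0 0<∣x₁∣ ,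
             torsor≡0 , admissible⇒conditions (admissible ∘ t-realises)
        where open NonDegenerate t-nonDegenerate

  Ψ-onto : ∀ x → E x → Σ Tup λ t → T₁ t × Ψ t ≡ x
  Ψ-onto (z4 (+ n₀) x₁ (+ n₂) x₃) (prim , product≢0 , +<+ 0<n₀ , +<+ 0<n₂ , curve≡0) =
    t nz prim curve≡0 , t∈T₁ nz prim curve≡0 , Ψt≡x nz prim curve≡0
    where
    open Preimage n₀ x₁ n₂ x₃
    nz : AllNonzero (z4 (+ n₀) x₁ (+ n₂) x₃)
    nz = product≢0⇒allNonzero (z4 (+ n₀) x₁ (+ n₂) x₃) product≢0

lemma13 : (∀ t → T₁ t → E (Ψ t))
    × (∀ t u → T₁ t → T₁ u → Ψ t ≡ Ψ u → t ≡ u)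
    × (∀ x → E x → Σ Tup (λ t → T₁ t × Ψ t ≡ x))
lemma13 = Ψ-into-E , Ψ-injective , Ψ-onto
  where open Parametrisation
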